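{- For every $n\ge 1$ there is a Horn (and hence URC) CNF formula $\varphi_n$ of size $O(n)$ such that (a) every PC formula equivalent to $\varphi_n$ has size $2^{\Omega(n)}$, and (b) there is a PC encoding of (the function represented by) $\varphi_n$ of size $O(n)$.
   Context: A CNF formula is a set of clauses; its size $|\varphi|$ is the number of clauses. A clause is Horn if it contains at most one positive literal; a Horn formula is a CNF of Horn clauses. A partial assignment $\alpha$ of variables $\mathbf{x}$ is a set of literals on $\mathbf{x}$ with no complementary pair, identified with the conjunction of its literals. Unit resolution derives $C\setminus\{l\}$ from a clause $C\ni l$ and the unit clause $\neg l$; $\varphi\vdash_1 C$ means $C$ is derivable by repeated unit resolution; $\bot$ is the empty clause. $\varphi(\mathbf{x})$ is URC if for every partial assignment $\alpha$ of $\mathbf{x}$, $\varphi\wedge\alpha\models\bot$ implies $\varphi\wedge\alpha\vdash_1\bot$; it is PC if for every partial assignment $\alpha$ and literal $l$ on $\mathbf{x}$ with $\varphi\wedge\alpha\models l$ we have $\varphi\wedge\alpha\vdash_1 l$ or $\varphi\wedge\alpha\vdash_1\bot$. A PC formula equivalent to $\varphi_n$ uses only the variables of $\varphi_n$. A CNF $\psi(\mathbf{x},\mathbf{y})$ is an encoding of a Boolean function $f(\mathbf{x})$ if for every $\mathbf{a}\in\{0,1\}^{\mathbf{x}}$, $f(\mathbf{a})=\exists\mathbf{b}\in\{0,1\}^{\mathbf{y}}\,\psi(\mathbf{a},\mathbf{b})$ ($\mathbf{y}$ are auxiliary variables); a PC encoding is an encoding that is a PC formula (over all its variables $\mathbf{x}\cup\mathbf{y}$).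 -}

module Defs where

open import Data.Nat using (ℕ; _≤_)
open import Data.Bool using (Bool; true; false; not; _∧_; _∨_)
open import Data.Bool.Properties using () renaming (_≟_ to _≟ᵇ_)
open import Data.Fin using (Fin) renaming (_≟_ to _≟ᶠ_)
open import Data.Product using (_×_; _,_; proj₁; proj₂; Σ; ∃)
open import Data.Product.Properties using (≡-dec)
open import Data.List using (List; []; _∷_; map; filter; length) renaming (_++_ to _++ˡ_)
open import Data.Bool.ListAction using (all; any)
open import Data.List.Membership.Propositional using (_∈_; _∉_)
open import Data.Vec.Functional using (Vector) renaming (_++_ to _++ᵛ_)
open import Relation.Nullary using (¬_; Dec; ¬?)
open import Relation.Binary.PropositionalEquality using (_≡_)
open import Data.Empty using (⊥)
open import Data.Sum using (_⊎_)

-- A literal on variables Fin m: (sign , variable); sign true = positive literal x, false = ¬x.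
Lit : ℕ → Set
Lit m = Bool × Fin m

_≟ₗ_ : ∀ {m} (l l′ : Lit m) → Dec (l ≡ l′)
_≟ₗ_ = ≡-dec _≟ᵇ_ _≟ᶠ_

∼_ : ∀ {m} → Lit m → Lit m
∼ (s , x) = (not s , x)

Clause : ℕ → Set
Clause m = List (Lit m)

CNF : ℕ → Set
CNF m = List (Clause m)

size : ∀ {m} → CNF m → ℕ
size = length

Assignment : ℕ → Set
Assignment m = Fin m → Bool

evalLit : ∀ {m} → Assignment m → Lit m → Bool
evalLit a (true , x) = a x
evalLit a (false , x) = not (a x)

evalClause : ∀ {m} → Assignment m → Clause m → Bool
evalClause a C = any (evalLit a) C

evalCNF : ∀ {m} → Assignment m → CNF m → Bool
evalCNF a φ = all (evalClause a) φ

positive? : ∀ {m} → (l : Lit m) → Dec (proj₁ l ≡ true)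
positive? l = proj₁ l ≟ᵇ true

HornClause : ∀ {m} → Clause m → Set
HornClause C = length (filter positive? C) ≤ 1

Horn : ∀ {m} → CNF m → Set
Horn φ = ∀ C → C ∈ φ → HornClause C

-- partial assignment: list of literals with no complementary pair,
-- identified with the conjunction of its literals (unit clauses)
Consistent : ∀ {m} → List (Lit m) → Set
Consistent α = ∀ l → l ∈ α → (∼ l) ∉ α

_∧ᵖ_ : ∀ {m} → CNF m → List (Lit m) → CNF m
φ ∧ᵖ α = φ ++ˡ map (λ l → l ∷ []) α

-- clauses are sets: equality of clauses up to order/repetition
_≋_ : ∀ {m} → Clause m → Clause m → Set
C ≋ D = (∀ l → l ∈ C → l ∈ D) × (∀ l → l ∈ D → l ∈ C)

remove : ∀ {m} → Lit m → Clause m → Clause m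
remove l C = filter (λ l′ → ¬? (l′ ≟ₗ l)) C

data UnitDerives {m} (φ : CNF m) : Clause m → Set where
  axiom   : ∀ {C} → C ∈ φ → UnitDerives φ C
  resolve : ∀ {C D l} → UnitDerives φ C → l ∈ C →
            UnitDerives φ D → D ≋ ((∼ l) ∷ []) →
            UnitDerives φ (remove l C)

_⊢₁_ : ∀ {m} → CNF m → Clause m → Set
φ ⊢₁ C = ∃ λ D → UnitDerives φ D × D ≋ C

Unsat : ∀ {m} → CNF m → Set
Unsat φ = ∀ a → evalCNF a φ ≡ true → ⊥

_⊨ₗ_ : ∀ {m} → CNF m → Lit m → Set
φ ⊨ₗ l = ∀ a → evalCNF a φ ≡ true → evalLit a l ≡ true

URC : ∀ {m} → CNF m → Set
URC φ = ∀ α → Consistent α → Unsat (φ ∧ᵖ α) → (φ ∧ᵖ α) ⊢₁ []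

PC : ∀ {m} → CNF m → Set
PC φ = ∀ α → Consistent α → ∀ l → (φ ∧ᵖ α) ⊨ₗ l →
       ((φ ∧ᵖ α) ⊢₁ (l ∷ [])) ⊎ ((φ ∧ᵖ α) ⊢₁ [])

Equivalent : ∀ {m} → CNF m → CNF m → Set
Equivalent φ ψ = ∀ a → evalCNF a φ ≡ evalCNF a ψ

-- ψ over variables x = Fin m (first block) and auxiliary y = Fin k (second block)
-- is an encoding of the function represented by φ
IsEncoding : ∀ {m k} → CNF m → CNF (m Data.Nat.+ k) → Set
IsEncoding {m} {k} φ ψ =
  ∀ (a : Assignment m) →
    (evalCNF a φ ≡ true → Σ (Assignment k) λ b → evalCNF (a ++ᵛ b) ψ ≡ true) ×
    (Σ (Assignment k) (λ b → evalCNF (a ++ᵛ b) ψ ≡ true) → evalCNF a φ ≡ true)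

-- φₙ has variables s, xᵢ, yᵢ, wᵢ (i < n) and the Horn clauses s ∧ xᵢ → wᵢ, s ∧ yᵢ → wᵢ and
-- ¬w₁ ∨ … ∨ ¬wₙ.  Pick uᵢ ∈ {xᵢ, yᵢ} for every i and let α = {u₁, …, uₙ}.  Then φₙ ∧ α implies ¬s,
-- while every other literal it implies already lies in α.  In a PC formula χ ≡ φₙ, a unit derivation
-- of ¬s from χ ∧ α can therefore only resolve away complements of α, so it starts from a clause of χ
-- made of ¬s and negations of α; evaluating χ at suitable models shows that this clause contains every
-- ¬uᵢ.  The 2ⁿ choices of α thus need 2ⁿ distinct clauses.
-- Adding rᵢ with xᵢ → rᵢ, yᵢ → rᵢ, wᵢ → rᵢ and s → ¬r₁ ∨ … ∨ ¬rₙ gives a Horn encoding with 5n + 2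
-- clauses.  A Horn formula is URC, and it is PC as soon as every variable left unassigned by unit
-- propagation can be set to true in some model extending the propagated literals; for the encoding
-- such a model sets w and r true except at one suitably chosen index.

module Submission where

open import Defs
open import Data.Nat using (ℕ; zero; suc; _+_; _*_; _^_; _/_; _≤_; _<_; z≤n; s≤s)
import Data.Nat.Properties as ℕ
open import Data.Bool using (Bool; true; false; not; _∨_)
open import Data.Bool.Properties using (not-involutive; ∨-identityʳ; ∨-zeroʳ)
open import Data.Fin as Fin using (Fin; _↑ˡ_; _↑ʳ_; splitAt; funToFin; finToFun)
open import Data.Fin.Properties using (splitAt-↑ˡ; splitAt-↑ʳ; join-splitAt; funToFin-finToFin; injective⇒≤; suc-injective; any?)
open import Function using (_∘_)
open import Data.Vec.Functional using () renaming (_++_ to _++ᵛ_)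
open import Data.Product using (_×_; Σ; ∃; _,_; proj₁; proj₂)
open import Data.Sum using (_⊎_; inj₁; inj₂; [_,_]′)
open import Data.Maybe using (Maybe; just; nothing)
open import Data.Maybe.Properties using (just-injective)
open import Data.List using (List; []; _∷_; map; filter; length; _++_; allFin; tabulate; lookup)
open import Data.List.Properties using (filter-accept; filter-reject; length-filter; length-++; length-tabulate)
open import Data.List.Membership.Propositional using (_∈_; _∉_; find)
open import Data.List.Membership.Propositional.Properties
open import Data.List.Relation.Unary.Any as Any using (Any; here; there)
open import Data.List.Relation.Unary.All as All using (All)
open import Data.List.Relation.Unary.Any.Properties using (lookup-index)
open import Data.List.Relation.Unary.All.Properties.Core using (¬All⇒Any¬)
open import Data.Bool.ListAction using (all; any)
open import Relation.Nullary using (¬_; Dec; yes; no; ¬?; does)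
open import Relation.Binary.PropositionalEquality
open import Data.Empty using (⊥; ⊥-elim)
open import Induction.WellFounded using (Acc; acc)
open import Data.Nat.Induction using (<-wellFounded)
open import Data.Nat.DivMod using (n/1≡n)

any⇒∃ : ∀ {A : Set} (p : A → Bool) (xs : List A) → any p xs ≡ true → ∃ λ x → x ∈ xs × p x ≡ true
any⇒∃ p (x ∷ xs) h with p x in eq
... | true = x , here refl , eq
... | false with any⇒∃ p xs h
... | y , y∈xs , py = y , there y∈xs , py

∃⇒any : ∀ {A : Set} (p : A → Bool) {xs : List A} {x} → x ∈ xs → p x ≡ true → any p xs ≡ true
∃⇒any p (here refl) px rewrite px = refl
∃⇒any p {y ∷ _} (there x∈xs) px with p y
... | true = refl
... | false = ∃⇒any p x∈xs px

all⇒∀ : ∀ {A : Set} (p : A → Bool) {xs : List A} → all p xs ≡ true → ∀ {x} → x ∈ xs → p x ≡ true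
all⇒∀ p {x ∷ _} h (here refl) with p x | h
... | true | _ = refl
all⇒∀ p {y ∷ _} h (there x∈xs) with p y | h
... | true | h′ = all⇒∀ p h′ x∈xs

∀⇒all : ∀ {A : Set} (p : A → Bool) (xs : List A) → (∀ x → x ∈ xs → p x ≡ true) → all p xs ≡ true
∀⇒all p [] h = refl
∀⇒all p (x ∷ xs) h rewrite h x (here refl) = ∀⇒all p xs (λ y y∈xs → h y (there y∈xs))

∼-involutive : ∀ {m} (l : Lit m) → ∼ (∼ l) ≡ l
∼-involutive (s , x) = cong (_, x) (not-involutive s)

evalLit-∼ : ∀ {m} (a : Assignment m) (l : Lit m) → evalLit a (∼ l) ≡ not (evalLit a l)
evalLit-∼ a (true , x) = refl
evalLit-∼ a (false , x) = sym (not-involutive (a x))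

evalLit-∼-false : ∀ {m} (a : Assignment m) (l : Lit m) → evalLit a l ≡ true → evalLit a (∼ l) ≡ true → ⊥
evalLit-∼-false a l al a∼l with evalLit a l | evalLit-∼ a l
... | true | e with trans (sym e) a∼l
... | ()

infix 4 _∈?_
_∈?_ : ∀ {m} (k : Lit m) (S : List (Lit m)) → Dec (k ∈ S)
k ∈? S = Any.any? (k ≟ₗ_) S

evalClause-≋ : ∀ {m} (a : Assignment m) {C D} → C ≋ D → evalClause a C ≡ true → evalClause a D ≡ true
evalClause-≋ a {C} (C⊆D , _) h with any⇒∃ (evalLit a) C h
... | k , k∈C , ak = ∃⇒any (evalLit a) (C⊆D k k∈C) ak

UnitDerives-sound : ∀ {m} {Γ : CNF m} {D} → UnitDerives Γ D → ∀ a → evalCNF a Γ ≡ true → evalClause a D ≡ true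
UnitDerives-sound (axiom D∈Γ) a h = all⇒∀ (evalClause a) h D∈Γ
UnitDerives-sound (resolve {C} {D} {l} dC l∈C dD D≋∼l) a h
  with any⇒∃ (evalLit a) C (UnitDerives-sound dC a h) | any⇒∃ (evalLit a) D (UnitDerives-sound dD a h)
... | k , k∈C , ak | j , j∈D , aj with proj₁ D≋∼l j j∈D
... | here refl = ∃⇒any (evalLit a) (∈-filter⁺ (λ l′ → ¬? (l′ ≟ₗ l)) k∈C k≢l) ak
  where
  k≢l : ¬ (k ≡ l)
  k≢l refl = evalLit-∼-false a k ak aj

⊢₁-sound : ∀ {m} {Γ : CNF m} {C} → Γ ⊢₁ C → ∀ a → evalCNF a Γ ≡ true → evalClause a C ≡ true
⊢₁-sound (D , dD , D≋C) a h = evalClause-≋ a D≋C (UnitDerives-sound dD a h)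

-- Unit propagation

AllDerivable : ∀ {m} → CNF m → List (Lit m) → Set
AllDerivable Γ S = ∀ k → k ∈ S → Γ ⊢₁ (k ∷ [])

resolveAway : ∀ {m} {Γ : CNF m} (L : List (Lit m)) → (∀ k → k ∈ L → Γ ⊢₁ (∼ k ∷ [])) →
  ∀ {X} → UnitDerives Γ X →
  ∃ λ X′ → UnitDerives Γ X′ × (∀ k → k ∈ X′ → k ∈ X × k ∉ L) × (∀ k → k ∈ X → k ∉ L → k ∈ X′)
resolveAway [] _ {X} dX = X , dX , (λ k k∈X → k∈X , λ ()) , (λ k k∈X _ → k∈X)
resolveAway (l ∷ L) ∼L {X} dX with l ∈? X
... | no l∉X with resolveAway L (λ k k∈L → ∼L k (there k∈L)) dX
...   | X′ , dX′ , sub , sup = X′ , dX′ , sub′ , (λ k k∈X k∉ → sup k k∈X (λ k∈L → k∉ (there k∈L)))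
  where
  sub′ : ∀ k → k ∈ X′ → k ∈ X × k ∉ l ∷ L
  sub′ k k∈X′ with sub k k∈X′
  ... | k∈X , k∉L = k∈X , λ { (here refl) → l∉X k∈X ; (there k∈L) → k∉L k∈L }
resolveAway (l ∷ L) ∼L {X} dX | yes l∈X with ∼L l (here refl)
... | D , dD , D≋∼l with resolveAway L (λ k k∈L → ∼L k (there k∈L)) (resolve dX l∈X dD D≋∼l)
...   | X′ , dX′ , sub , sup = X′ , dX′ , sub′ , sup′
  where
  sub′ : ∀ k → k ∈ X′ → k ∈ X × k ∉ l ∷ L
  sub′ k k∈X′ with sub k k∈X′
  ... | k∈X-l , k∉L with ∈-filter⁻ (λ l′ → ¬? (l′ ≟ₗ l)) k∈X-l
  ...   | k∈X , k≢l = k∈X , λ { (here k≡l) → k≢l k≡l ; (there k∈L) → k∉L k∈L }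
  sup′ : ∀ k → k ∈ X → k ∉ l ∷ L → k ∈ X′
  sup′ k k∈X k∉ =
    sup k (∈-filter⁺ (λ l′ → ¬? (l′ ≟ₗ l)) k∈X (λ k≡l → k∉ (here k≡l))) (λ k∈L → k∉ (there k∈L))

residual : ∀ {m} → List (Lit m) → Clause m → Clause m
residual S C = filter (λ k → ¬? (∼ k ∈? S)) C

⊢₁-residual : ∀ {m} {Γ : CNF m} {S} → AllDerivable Γ S → ∀ {C} → C ∈ Γ → Γ ⊢₁ residual S C
⊢₁-residual {Γ = Γ} {S} ⊢S {C} C∈Γ with resolveAway (map ∼_ S) ⊢∼∼S (axiom C∈Γ)
  where
  ⊢∼∼S : ∀ k → k ∈ map ∼_ S → Γ ⊢₁ (∼ k ∷ [])
  ⊢∼∼S k k∈∼S with ∈-map⁻ ∼_ k∈∼S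
  ... | j , j∈S , refl = subst (λ j′ → Γ ⊢₁ (j′ ∷ [])) (sym (∼-involutive j)) (⊢S j j∈S)
... | X′ , dX′ , sub , sup = X′ , dX′ , X′⊆res , res⊆X′
  where
  ∼∈S⇒∈∼S : ∀ k → ∼ k ∈ S → k ∈ map ∼_ S
  ∼∈S⇒∈∼S k ∼k∈S = subst (_∈ map ∼_ S) (∼-involutive k) (∈-map⁺ ∼_ ∼k∈S)
  ∈∼S⇒∼∈S : ∀ k → k ∈ map ∼_ S → ∼ k ∈ S
  ∈∼S⇒∼∈S k k∈∼S with ∈-map⁻ ∼_ k∈∼S
  ... | j , j∈S , refl = subst (_∈ S) (sym (∼-involutive j)) j∈S
  X′⊆res : ∀ k → k ∈ X′ → k ∈ residual S C
  X′⊆res k k∈X′ with sub k k∈X′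
  ... | k∈C , k∉∼S = ∈-filter⁺ (λ k → ¬? (∼ k ∈? S)) k∈C (λ ∼k∈S → k∉∼S (∼∈S⇒∈∼S k ∼k∈S))
  res⊆X′ : ∀ k → k ∈ residual S C → k ∈ X′
  res⊆X′ k k∈res with ∈-filter⁻ (λ k → ¬? (∼ k ∈? S)) k∈res
  ... | k∈C , ∼k∉S = sup k k∈C (λ k∈∼S → ∼k∉S (∈∼S⇒∼∈S k k∈∼S))

⊢₁-complementary : ∀ {m} {Γ : CNF m} {k} → Γ ⊢₁ (k ∷ []) → Γ ⊢₁ (∼ k ∷ []) → Γ ⊢₁ []
⊢₁-complementary {k = k} (D , dD , D≋k) (E , dE , E≋∼k) =
  remove k D , resolve dD (proj₂ D≋k k (here refl)) dE E≋∼k , D-k⊆[] , λ _ ()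
  where
  D-k⊆[] : ∀ j → j ∈ remove k D → j ∈ []
  D-k⊆[] j j∈D-k with ∈-filter⁻ (λ l′ → ¬? (l′ ≟ₗ k)) j∈D-k
  ... | j∈D , j≢k with proj₁ D≋k j j∈D
  ... | here j≡k = ⊥-elim (j≢k j≡k)

Quiet : ∀ {m} → List (Lit m) → Clause m → Set
Quiet S C = Any (_∈ S) C ⊎ 2 ≤ length (residual S C)

quiet? : ∀ {m} (S : List (Lit m)) (C : Clause m) → Dec (Quiet S C)
quiet? S C with Any.any? (_∈? S) C | 2 ℕ.≤? length (residual S C)
... | yes sat | _ = yes (inj₁ sat)
... | no _ | yes open₂ = yes (inj₂ open₂)
... | no ¬sat | no ¬open₂ = no λ { (inj₁ sat) → ¬sat sat ; (inj₂ open₂) → ¬open₂ open₂ }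

Stable : ∀ {m} → CNF m → List (Lit m) → Set
Stable Γ S = ∀ C → C ∈ Γ → Quiet S C

allLits : ∀ m → List (Lit m)
allLits m = map (true ,_) (allFin m) ++ map (false ,_) (allFin m)

∈-allLits : ∀ {m} (k : Lit m) → k ∈ allLits m
∈-allLits (true , v) = ∈-++⁺ˡ (∈-map⁺ (true ,_) (∈-allFin v))
∈-allLits {m} (false , v) = ∈-++⁺ʳ (map (true ,_) (allFin m)) (∈-map⁺ (false ,_) (∈-allFin v))

module _ {A : Set} {P Q : A → Set} (P? : ∀ x → Dec (P x)) (Q? : ∀ x → Dec (Q x)) (Q⇒P : ∀ x → Q x → P x) where

  length-filter-mono : ∀ xs → length (filter Q? xs) ≤ length (filter P? xs)
  length-filter-mono [] = z≤n
  length-filter-mono (x ∷ xs) with Q? x | P? x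
  ... | yes _ | yes _ = s≤s (length-filter-mono xs)
  ... | yes q | no ¬p = ⊥-elim (¬p (Q⇒P x q))
  ... | no _ | yes _ = ℕ.m≤n⇒m≤1+n (length-filter-mono xs)
  ... | no _ | no _ = length-filter-mono xs

  length-filter-mono-< : ∀ {y} xs → y ∈ xs → P y → ¬ Q y → length (filter Q? xs) < length (filter P? xs)
  length-filter-mono-< (_ ∷ xs) (here refl) p ¬q
    rewrite filter-reject Q? {xs = xs} ¬q | filter-accept P? {xs = xs} p = s≤s (length-filter-mono xs)
  length-filter-mono-< (x ∷ xs) (there y∈xs) p ¬q with Q? x | P? x
  ... | yes _ | yes _ = s≤s (length-filter-mono-< xs y∈xs p ¬q)
  ... | yes q | no ¬p = ⊥-elim (¬p (Q⇒P x q))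
  ... | no _ | yes _ = ℕ.m≤n⇒m≤1+n (length-filter-mono-< xs y∈xs p ¬q)
  ... | no _ | no _ = length-filter-mono-< xs y∈xs p ¬q

unassigned : ∀ {m} → List (Lit m) → ℕ
unassigned {m} S = length (filter (λ k → ¬? (k ∈? S)) (allLits m))

unassigned-< : ∀ {m} {k : Lit m} S → k ∉ S → unassigned (k ∷ S) < unassigned S
unassigned-< {m} {k} S k∉S =
  length-filter-mono-< (λ j → ¬? (j ∈? S)) (λ j → ¬? (j ∈? (k ∷ S))) (λ j j∉ j∈S → j∉ (there j∈S))
    (allLits m) (∈-allLits k) k∉S (λ k∉ → k∉ (here refl))

saturate : ∀ {m} (Γ : CNF m) S → Acc _<_ (unassigned S) → AllDerivable Γ S →
  Γ ⊢₁ [] ⊎ ∃ λ S′ → AllDerivable Γ S′ × Stable Γ S′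
saturate Γ S (acc smaller) ⊢S with All.all? (quiet? S) Γ
... | yes quiet = inj₂ (S , ⊢S , λ C C∈Γ → All.lookup quiet C∈Γ)
... | no ¬quiet with find (¬All⇒Any¬ (quiet? S) Γ ¬quiet)
...   | C , C∈Γ , loud = byResidual (residual S C) refl
  where
  byResidual : ∀ r → residual S C ≡ r → Γ ⊢₁ [] ⊎ ∃ λ S′ → AllDerivable Γ S′ × Stable Γ S′
  byResidual [] eq = inj₁ (subst (Γ ⊢₁_) eq (⊢₁-residual ⊢S C∈Γ))
  byResidual (_ ∷ _ ∷ _) eq = ⊥-elim (loud (inj₂ (subst (λ r → 2 ≤ length r) (sym eq) (s≤s (s≤s z≤n)))))
  byResidual (k ∷ []) eq = saturate Γ (k ∷ S) (smaller (unassigned-< S k∉S)) ⊢k∷S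
    where
    k∈C : k ∈ C
    k∈C = proj₁ (∈-filter⁻ (λ k → ¬? (∼ k ∈? S)) (subst (k ∈_) (sym eq) (here refl)))
    k∉S : k ∉ S
    k∉S k∈S = loud (inj₁ (Any.map (λ { refl → k∈S }) k∈C))
    ⊢k∷S : AllDerivable Γ (k ∷ S)
    ⊢k∷S j (here refl) = subst (Γ ⊢₁_) eq (⊢₁-residual ⊢S C∈Γ)
    ⊢k∷S j (there j∈S) = ⊢S j j∈S

record Propagated {m} (Γ : CNF m) : Set where
  field
    lits       : List (Lit m)
    derivable  : AllDerivable Γ lits
    stable     : Stable Γ lits
    consistent : Consistent lits

unitPropagate : ∀ {m} (Γ : CNF m) → Γ ⊢₁ [] ⊎ Propagated Γ
unitPropagate Γ with saturate Γ [] (<-wellFounded _) (λ _ ())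
... | inj₁ ⊢⊥ = inj₁ ⊢⊥
... | inj₂ (S , ⊢S , stable) with Any.any? (λ k → ∼ k ∈? S) S
...   | yes clash = let k , k∈S , ∼k∈S = find clash in inj₁ (⊢₁-complementary (⊢S k k∈S) (⊢S (∼ k) ∼k∈S))
...   | no ¬clash = inj₂ record
  { lits = S ; derivable = ⊢S ; stable = stable
  ; consistent = λ k k∈S ∼k∈S → ¬clash (Any.map (λ { refl → ∼k∈S }) k∈S) }

-- Horn formulas

∈-∧ᵖ⁻ : ∀ {m} (ψ : CNF m) α {C} → C ∈ ψ ∧ᵖ α → C ∈ ψ ⊎ ∃ λ k → k ∈ α × C ≡ k ∷ []
∈-∧ᵖ⁻ ψ α C∈ with ∈-++⁻ ψ C∈
... | inj₁ C∈ψ = inj₁ C∈ψ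
... | inj₂ C∈α with ∈-map⁻ (λ l → l ∷ []) C∈α
...   | k , k∈α , refl = inj₂ (k , k∈α , refl)

unit-∈-∧ᵖ : ∀ {m} (ψ : CNF m) {α k} → k ∈ α → (k ∷ []) ∈ ψ ∧ᵖ α
unit-∈-∧ᵖ ψ k∈α = ∈-++⁺ʳ ψ (∈-map⁺ (λ l → l ∷ []) k∈α)

evalCNF-∧ᵖ⁻ : ∀ {m} (ψ : CNF m) α a → evalCNF a (ψ ∧ᵖ α) ≡ true →
  evalCNF a ψ ≡ true × (∀ k → k ∈ α → evalLit a k ≡ true)
evalCNF-∧ᵖ⁻ ψ α a h =
  ∀⇒all _ ψ (λ C C∈ψ → all⇒∀ (evalClause a) h (∈-++⁺ˡ C∈ψ)) ,
  λ k k∈α → trans (sym (∨-identityʳ _)) (all⇒∀ (evalClause a) h (unit-∈-∧ᵖ ψ k∈α))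

evalCNF-∧ᵖ⁺ : ∀ {m} (ψ : CNF m) α a → evalCNF a ψ ≡ true → (∀ k → k ∈ α → evalLit a k ≡ true) →
  evalCNF a (ψ ∧ᵖ α) ≡ true
evalCNF-∧ᵖ⁺ ψ α a aψ aα = ∀⇒all _ (ψ ∧ᵖ α) sat
  where
  sat : ∀ C → C ∈ ψ ∧ᵖ α → evalClause a C ≡ true
  sat C C∈ with ∈-∧ᵖ⁻ ψ α C∈
  ... | inj₁ C∈ψ = all⇒∀ (evalClause a) aψ C∈ψ
  ... | inj₂ (k , k∈α , refl) = trans (∨-identityʳ _) (aα k k∈α)

Stable-∧ᵖ⁻ : ∀ {m} (ψ : CNF m) α {S} → Stable (ψ ∧ᵖ α) S → Stable ψ S × (∀ k → k ∈ α → k ∈ S)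
Stable-∧ᵖ⁻ ψ α {S} stable = (λ C C∈ψ → stable C (∈-++⁺ˡ C∈ψ)) , α⊆S
  where
  α⊆S : ∀ k → k ∈ α → k ∈ S
  α⊆S k k∈α with stable (k ∷ []) (unit-∈-∧ᵖ ψ k∈α)
  ... | inj₁ (here k∈S) = k∈S
  ... | inj₂ two≤ = ⊥-elim (ℕ.<⇒≱ two≤ (length-filter (λ j → ¬? (∼ j ∈? S)) (k ∷ [])))

minimalModel : ∀ {m} → List (Lit m) → Assignment m
minimalModel S v = does ((true , v) ∈? S)

minimalModel-true : ∀ {m} {S : List (Lit m)} {v} → (true , v) ∈ S → minimalModel S v ≡ true
minimalModel-true {S = S} {v} v∈S with (true , v) ∈? S
... | yes _ = refl
... | no v∉S = ⊥-elim (v∉S v∈S)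

minimalModel-false : ∀ {m} {S : List (Lit m)} {v} → (true , v) ∉ S → minimalModel S v ≡ false
minimalModel-false {S = S} {v} v∉S with (true , v) ∈? S
... | yes v∈S = ⊥-elim (v∉S v∈S)
... | no _ = refl

minimalModel-lits : ∀ {m} {S : List (Lit m)} → Consistent S → ∀ k → k ∈ S → evalLit (minimalModel S) k ≡ true
minimalModel-lits consistent (true , v) v∈S = minimalModel-true v∈S
minimalModel-lits consistent (false , v) ¬v∈S rewrite minimalModel-false (consistent (false , v) ¬v∈S) = refl

HornClause-negative : ∀ {m} {Q : Lit m → Set} (Q? : ∀ k → Dec (Q k)) (C : Clause m) j →
  length (filter positive? C) ≤ j → j < length (filter Q? C) → ∃ λ k → k ∈ C × Q k × proj₁ k ≡ false
HornClause-negative Q? (k ∷ C) j pos≤j j<Q with Q? k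
HornClause-negative Q? ((false , v) ∷ C) j pos≤j j<Q | yes q = (false , v) , here refl , q , refl
HornClause-negative Q? ((true , v) ∷ C) (suc j) (s≤s pos≤j) (s≤s j<Q) | yes _
  with HornClause-negative Q? C j pos≤j j<Q
... | k′ , k′∈C , q , neg = k′ , there k′∈C , q , neg
HornClause-negative Q? ((false , v) ∷ C) j pos≤j j<Q | no _ with HornClause-negative Q? C j pos≤j j<Q
... | k′ , k′∈C , q , neg = k′ , there k′∈C , q , neg
HornClause-negative Q? ((true , v) ∷ C) j pos<j j<Q | no _ with HornClause-negative Q? C j (ℕ.<⇒≤ pos<j) j<Q
... | k′ , k′∈C , q , neg = k′ , there k′∈C , q , neg

minimalModel-quiet : ∀ {m} {S : List (Lit m)} → Consistent S → ∀ C → HornClause C → Quiet S C →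
  evalClause (minimalModel S) C ≡ true
minimalModel-quiet consistent C horn (inj₁ sat) with find sat
... | k , k∈C , k∈S = ∃⇒any (evalLit _) k∈C (minimalModel-lits consistent k k∈S)
minimalModel-quiet {S = S} consistent C horn (inj₂ two≤)
  with HornClause-negative (λ k → ¬? (∼ k ∈? S)) C 1 horn two≤
... | (false , v) , k∈C , v∉S , refl = ∃⇒any (evalLit _) k∈C (cong not (minimalModel-false v∉S))

minimalModel-sat : ∀ {m} (Γ : CNF m) → Horn Γ → ∀ {S} → Stable Γ S → Consistent S →
  evalCNF (minimalModel S) Γ ≡ true
minimalModel-sat Γ horn stable consistent =
  ∀⇒all _ Γ λ C C∈Γ → minimalModel-quiet consistent C (horn C C∈Γ) (stable C C∈Γ)

Horn-∧ᵖ : ∀ {m} (φ : CNF m) α → Horn φ → Horn (φ ∧ᵖ α)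
Horn-∧ᵖ φ α horn C C∈ with ∈-∧ᵖ⁻ φ α C∈
... | inj₁ C∈φ = horn C C∈φ
... | inj₂ (k , _ , refl) = length-filter positive? (k ∷ [])

Horn⇒URC : ∀ {m} (φ : CNF m) → Horn φ → URC φ
Horn⇒URC φ horn α _ unsat with unitPropagate (φ ∧ᵖ α)
... | inj₁ ⊢⊥ = ⊢⊥
... | inj₂ P = ⊥-elim (unsat _ (minimalModel-sat (φ ∧ᵖ α) (Horn-∧ᵖ φ α horn) stable consistent))
  where open Propagated P

FreeExtensions : ∀ {m} → CNF m → Set
FreeExtensions {m} ψ = ∀ S → Stable ψ S → Consistent S → ∀ t → (true , t) ∉ S → (false , t) ∉ S →
  Σ (Assignment m) λ M → evalCNF M ψ ≡ true × (∀ k → k ∈ S → evalLit M k ≡ true) × M t ≡ true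

-- For Horn formulas the minimal model of the propagated literals refutes every underived
-- positive literal; negative literals need models setting an unassigned variable to true.
Horn⇒PC : ∀ {m} (ψ : CNF m) → Horn ψ → FreeExtensions ψ → PC ψ
Horn⇒PC ψ horn free α _ l ψα⊨l with unitPropagate (ψ ∧ᵖ α)
... | inj₁ ⊢⊥ = inj₂ ⊢⊥
... | inj₂ P with l ∈? Propagated.lits P
...   | yes l∈S = inj₁ (Propagated.derivable P l l∈S)
...   | no l∉S = ⊥-elim (refuted l l∉S ψα⊨l)
  where
  open Propagated P renaming (lits to S)
  stableψ : Stable ψ S
  stableψ = proj₁ (Stable-∧ᵖ⁻ ψ α stable)
  α⊆S : ∀ k → k ∈ α → k ∈ S
  α⊆S = proj₂ (Stable-∧ᵖ⁻ ψ α stable)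
  minimal : evalCNF (minimalModel S) (ψ ∧ᵖ α) ≡ true
  minimal = minimalModel-sat (ψ ∧ᵖ α) (Horn-∧ᵖ ψ α horn) stable consistent
  refuted : ∀ l → l ∉ S → (ψ ∧ᵖ α) ⊨ₗ l → ⊥
  refuted (true , t) t∉S ψα⊨t with trans (sym (ψα⊨t _ minimal)) (minimalModel-false t∉S)
  ... | ()
  refuted (false , t) ¬t∉S ψα⊨¬t with (true , t) ∈? S
  ... | yes t∈S with trans (sym (ψα⊨¬t _ minimal)) (cong not (minimalModel-true t∈S))
  ...   | ()
  refuted (false , t) ¬t∉S ψα⊨¬t | no t∉S with free S stableψ consistent t t∉S ¬t∉S
  ... | M , Mψ , MS , Mt
    with trans (sym (ψα⊨¬t M (evalCNF-∧ᵖ⁺ ψ α M Mψ (λ k k∈α → MS k (α⊆S k k∈α))))) (cong not Mt)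
  ...   | ()

-- The formulas φₙ and their encodings ψₙ

data Var (n : ℕ) : Set where
  vs : Var n
  vx vy vw : Fin n → Var n

-- vr i is the auxiliary variable rᵢ, standing for xᵢ ∨ yᵢ ∨ wᵢ.
data Var⁺ (n : ℕ) : Set where
  old : Var n → Var⁺ n
  vr  : Fin n → Var⁺ n

old-injective : ∀ {n} {u v : Var n} → old u ≡ old v → u ≡ v
old-injective refl = refl

V : ℕ → ℕ
V n = suc (n + (n + n))

toFin : ∀ {n} → Var n → Fin (V n)
toFin vs = Fin.zero
toFin {n} (vx i) = Fin.suc (i ↑ˡ (n + n))
toFin {n} (vy i) = Fin.suc (n ↑ʳ (i ↑ˡ n))
toFin {n} (vw i) = Fin.suc (n ↑ʳ (n ↑ʳ i))

fromFin : ∀ n → Fin (V n) → Var n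
fromFin n Fin.zero = vs
fromFin n (Fin.suc j) = [ vx , [ vy , vw ]′ ∘ splitAt n ]′ (splitAt n j)

fromFin-toFin : ∀ {n} (v : Var n) → fromFin n (toFin v) ≡ v
fromFin-toFin vs = refl
fromFin-toFin {n} (vx i) rewrite splitAt-↑ˡ n i (n + n) = refl
fromFin-toFin {n} (vy i) rewrite splitAt-↑ʳ n (n + n) (i ↑ˡ n) | splitAt-↑ˡ n i n = refl
fromFin-toFin {n} (vw i) rewrite splitAt-↑ʳ n (n + n) (n ↑ʳ i) | splitAt-↑ʳ n n i = refl

splitAt⇒join : ∀ a {b} (j : Fin (a + b)) {p} → splitAt a j ≡ p → Fin.join a b p ≡ j
splitAt⇒join a {b} j refl = join-splitAt a b j

toFin-fromFin : ∀ {n} (j : Fin (V n)) → toFin (fromFin n j) ≡ j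
toFin-fromFin Fin.zero = refl
toFin-fromFin {n} (Fin.suc j) with splitAt n j in eq
... | inj₁ i = cong Fin.suc (splitAt⇒join n j eq)
... | inj₂ k with splitAt n k in eq′
...   | inj₁ i = cong Fin.suc (trans (cong (n ↑ʳ_) (splitAt⇒join n k eq′)) (splitAt⇒join n j eq))
...   | inj₂ i = cong Fin.suc (trans (cong (n ↑ʳ_) (splitAt⇒join n k eq′)) (splitAt⇒join n j eq))

toFin-injective : ∀ {n} {u v : Var n} → toFin u ≡ toFin v → u ≡ v
toFin-injective {n} {u} {v} eq = trans (sym (fromFin-toFin u)) (trans (cong (fromFin n) eq) (fromFin-toFin v))

toFin⁺ : ∀ {n} → Var⁺ n → Fin (V n + n)
toFin⁺ {n} (old v) = toFin v ↑ˡ n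
toFin⁺ {n} (vr i) = V n ↑ʳ i

fromFin⁺ : ∀ n → Fin (V n + n) → Var⁺ n
fromFin⁺ n j = [ old ∘ fromFin n , vr ]′ (splitAt (V n) j)

fromFin⁺-toFin⁺ : ∀ {n} (v : Var⁺ n) → fromFin⁺ n (toFin⁺ v) ≡ v
fromFin⁺-toFin⁺ {n} (old v) rewrite splitAt-↑ˡ (V n) (toFin v) n = cong old (fromFin-toFin v)
fromFin⁺-toFin⁺ {n} (vr i) rewrite splitAt-↑ʳ (V n) n i = refl

toFin⁺-fromFin⁺ : ∀ {n} (j : Fin (V n + n)) → toFin⁺ (fromFin⁺ n j) ≡ j
toFin⁺-fromFin⁺ {n} j with splitAt (V n) j in eq
... | inj₁ k = trans (cong (_↑ˡ n) (toFin-fromFin k)) (splitAt⇒join (V n) j eq)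
... | inj₂ i = splitAt⇒join (V n) j eq

toFin⁺-injective : ∀ {n} {u v : Var⁺ n} → toFin⁺ u ≡ toFin⁺ v → u ≡ v
toFin⁺-injective {n} {u} {v} eq =
  trans (sym (fromFin⁺-toFin⁺ u)) (trans (cong (fromFin⁺ n) eq) (fromFin⁺-toFin⁺ v))

++-old : ∀ {n} (a : Assignment (V n)) (b : Assignment n) (v : Var n) → (a ++ᵛ b) (toFin⁺ (old v)) ≡ a (toFin v)
++-old {n} a b v rewrite splitAt-↑ˡ (V n) (toFin v) n = refl

++-vr : ∀ {n} (a : Assignment (V n)) (b : Assignment n) (i : Fin n) → (a ++ᵛ b) (toFin⁺ (vr i)) ≡ b i
++-vr {n} a b i rewrite splitAt-↑ʳ (V n) n i = refl

pos neg : ∀ {X : Set} {m} → (X → Fin m) → X → Lit m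
pos e v = (true , e v)
neg e v = (false , e v)

-- Parametrised by the embedding of the variables, so that the same clauses occur in φ n and in ψ n.
module Φ {n m : ℕ} (e : Var n → Fin m) where
  x⇒w y⇒w : Fin n → Clause m
  x⇒w i = neg e vs ∷ neg e (vx i) ∷ pos e (vw i) ∷ []
  y⇒w i = neg e vs ∷ neg e (vy i) ∷ pos e (vw i) ∷ []

  ¬allW : Clause m
  ¬allW = tabulate (neg e ∘ vw)

  clauses : CNF m
  clauses = ¬allW ∷ (tabulate x⇒w ++ tabulate y⇒w)

  ∈-¬allW : ¬allW ∈ clauses
  ∈-¬allW = here refl

  ∈-x⇒w : ∀ i → x⇒w i ∈ clauses
  ∈-x⇒w i = there (∈-++⁺ˡ (∈-tabulate⁺ i))

  ∈-y⇒w : ∀ i → y⇒w i ∈ clauses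
  ∈-y⇒w i = there (∈-++⁺ʳ (tabulate x⇒w) (∈-tabulate⁺ i))

  ∈-elim : (P : Clause m → Set) → P ¬allW → (∀ i → P (x⇒w i)) → (∀ i → P (y⇒w i)) →
    ∀ {C} → C ∈ clauses → P C
  ∈-elim P p¬allW px⇒w py⇒w (here refl) = p¬allW
  ∈-elim P p¬allW px⇒w py⇒w (there C∈) with ∈-++⁻ (tabulate x⇒w) C∈
  ... | inj₁ C∈x with ∈-tabulate⁻ C∈x
  ...   | i , refl = px⇒w i
  ∈-elim P p¬allW px⇒w py⇒w (there C∈) | inj₂ C∈y with ∈-tabulate⁻ C∈y
  ...   | i , refl = py⇒w i

φ : (n : ℕ) → CNF (V n)
φ n = Φ.clauses (toFin {n})

module Ψ (n : ℕ) where
  e : Var⁺ n → Fin (V n + n)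
  e = toFin⁺

  x⇒r y⇒r w⇒r : Fin n → Clause (V n + n)
  x⇒r i = neg e (old (vx i)) ∷ pos e (vr i) ∷ []
  y⇒r i = neg e (old (vy i)) ∷ pos e (vr i) ∷ []
  w⇒r i = neg e (old (vw i)) ∷ pos e (vr i) ∷ []

  s⇒¬allR : Clause (V n + n)
  s⇒¬allR = neg e (old vs) ∷ tabulate (neg e ∘ vr)

  rClauses : CNF (V n + n)
  rClauses = s⇒¬allR ∷ (tabulate x⇒r ++ (tabulate y⇒r ++ tabulate w⇒r))

  clauses : CNF (V n + n)
  clauses = Φ.clauses (e ∘ old) ++ rClauses

ψ : (n : ℕ) → CNF (V n + n)
ψ = Ψ.clauses

record ModelΦ {n} (A : Var n → Bool) : Set where
  field
    x⇒w : ∀ i → A vs ≡ true → A (vx i) ≡ true → A (vw i) ≡ true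
    y⇒w : ∀ i → A vs ≡ true → A (vy i) ≡ true → A (vw i) ≡ true
    ¬allW : ∃ λ i → A (vw i) ≡ false

record ModelΨ {n} (A : Var⁺ n → Bool) : Set where
  field
    modelΦ : ModelΦ (A ∘ old)
    x⇒r : ∀ i → A (old (vx i)) ≡ true → A (vr i) ≡ true
    y⇒r : ∀ i → A (old (vy i)) ≡ true → A (vr i) ≡ true
    w⇒r : ∀ i → A (old (vw i)) ≡ true → A (vr i) ≡ true
    s⇒¬allR : A (old vs) ≡ true → ∃ λ i → A (vr i) ≡ false

ModelΦ-cong : ∀ {n} {A B : Var n → Bool} → (∀ v → A v ≡ B v) → ModelΦ A → ModelΦ B
ModelΦ-cong A≗B M = record
  { x⇒w = λ i s x → trans (sym (A≗B _)) (ModelΦ.x⇒w M i (trans (A≗B _) s) (trans (A≗B _) x))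
  ; y⇒w = λ i s y → trans (sym (A≗B _)) (ModelΦ.y⇒w M i (trans (A≗B _) s) (trans (A≗B _) y))
  ; ¬allW = let i , wi = ModelΦ.¬allW M in i , trans (sym (A≗B _)) wi }

⇒₂-sound : ∀ p q r → not p ∨ (not q ∨ (r ∨ false)) ≡ true → p ≡ true → q ≡ true → r ≡ true
⇒₂-sound true true true _ refl refl = refl

⇒₂-complete : ∀ p q r → (p ≡ true → q ≡ true → r ≡ true) → not p ∨ (not q ∨ (r ∨ false)) ≡ true
⇒₂-complete false q r _ = refl
⇒₂-complete true false r _ = refl
⇒₂-complete true true true _ = refl
⇒₂-complete true true false h with h refl refl
... | ()

⇒₁-sound : ∀ p q → not p ∨ (q ∨ false) ≡ true → p ≡ true → q ≡ true
⇒₁-sound true true _ refl = refl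

⇒₁-complete : ∀ p q → (p ≡ true → q ≡ true) → not p ∨ (q ∨ false) ≡ true
⇒₁-complete false q _ = refl
⇒₁-complete true true _ = refl
⇒₁-complete true false h with h refl
... | ()

module _ {n m} (a : Assignment m) (f : Fin n → Fin m) where

  evalClause-negatives⁻ : evalClause a (tabulate (λ i → (false , f i))) ≡ true → ∃ λ i → a (f i) ≡ false
  evalClause-negatives⁻ h with any⇒∃ (evalLit a) _ h
  ... | k , k∈ , ak with ∈-tabulate⁻ {f = λ i → (false , f i)} k∈
  ...   | i , refl with a (f i) in eq
  ...     | false = i , eq

  evalClause-negatives⁺ : ∀ i → a (f i) ≡ false → evalClause a (tabulate (λ i → (false , f i))) ≡ true
  evalClause-negatives⁺ i h = ∃⇒any (evalLit a) (∈-tabulate⁺ {f = λ i → (false , f i)} i) (cong not h)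

module _ {n m} (e : Var n → Fin m) (a : Assignment m) where
  open Φ e

  evalCNF-Φ⁻ : evalCNF a clauses ≡ true → ModelΦ (a ∘ e)
  evalCNF-Φ⁻ h = record
    { x⇒w = λ i → ⇒₂-sound _ _ _ (sat (∈-x⇒w i))
    ; y⇒w = λ i → ⇒₂-sound _ _ _ (sat (∈-y⇒w i))
    ; ¬allW = evalClause-negatives⁻ a (e ∘ vw) (sat ∈-¬allW) }
    where
    sat : ∀ {C} → C ∈ clauses → evalClause a C ≡ true
    sat = all⇒∀ (evalClause a) h

  evalCNF-Φ⁺ : ModelΦ (a ∘ e) → evalCNF a clauses ≡ true
  evalCNF-Φ⁺ M = ∀⇒all _ clauses λ C → ∈-elim (λ C → evalClause a C ≡ true)
    (let i , wi = ModelΦ.¬allW M in evalClause-negatives⁺ a (e ∘ vw) i wi)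
    (λ i → ⇒₂-complete _ _ _ (ModelΦ.x⇒w M i))
    (λ i → ⇒₂-complete _ _ _ (ModelΦ.y⇒w M i))

module _ {n : ℕ} where
  open Ψ n

  ∈ψ-Φ : ∀ {C} → C ∈ Φ.clauses (e ∘ old) → C ∈ ψ n
  ∈ψ-Φ = ∈-++⁺ˡ

  ∈ψ-s⇒¬allR : s⇒¬allR ∈ ψ n
  ∈ψ-s⇒¬allR = ∈-++⁺ʳ (Φ.clauses (e ∘ old)) (here refl)

  ∈ψ-x⇒r : ∀ i → x⇒r i ∈ ψ n
  ∈ψ-x⇒r i = ∈-++⁺ʳ (Φ.clauses (e ∘ old)) (there (∈-++⁺ˡ (∈-tabulate⁺ i)))
  ∈ψ-y⇒r : ∀ i → y⇒r i ∈ ψ n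
  ∈ψ-y⇒r i = ∈-++⁺ʳ (Φ.clauses (e ∘ old)) (there (∈-++⁺ʳ (tabulate x⇒r) (∈-++⁺ˡ (∈-tabulate⁺ i))))
  ∈ψ-w⇒r : ∀ i → w⇒r i ∈ ψ n
  ∈ψ-w⇒r i =
    ∈-++⁺ʳ (Φ.clauses (e ∘ old)) (there (∈-++⁺ʳ (tabulate x⇒r) (∈-++⁺ʳ (tabulate y⇒r) (∈-tabulate⁺ i))))

  ∈ψ-elim : (P : Clause (V n + n) → Set) → (∀ {C} → C ∈ Φ.clauses (e ∘ old) → P C) → P s⇒¬allR →
    (∀ i → P (x⇒r i)) → (∀ i → P (y⇒r i)) → (∀ i → P (w⇒r i)) → ∀ {C} → C ∈ ψ n → P C
  ∈ψ-elim P pΦ ps px py pw C∈ with ∈-++⁻ (Φ.clauses (e ∘ old)) C∈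
  ... | inj₁ C∈Φ = pΦ C∈Φ
  ... | inj₂ (here refl) = ps
  ... | inj₂ (there C∈r) with ∈-++⁻ (tabulate x⇒r) C∈r
  ...   | inj₁ C∈x = let i , eq = ∈-tabulate⁻ C∈x in subst P (sym eq) (px i)
  ...   | inj₂ C∈yw with ∈-++⁻ (tabulate y⇒r) C∈yw
  ...     | inj₁ C∈y = let i , eq = ∈-tabulate⁻ C∈y in subst P (sym eq) (py i)
  ...     | inj₂ C∈w = let i , eq = ∈-tabulate⁻ C∈w in subst P (sym eq) (pw i)

module _ {n : ℕ} (a : Assignment (V n + n)) where
  open Ψ n

  evalCNF-Ψ⁻ : evalCNF a (ψ n) ≡ true → ModelΨ (a ∘ e)
  evalCNF-Ψ⁻ h = record
    { modelΦ = evalCNF-Φ⁻ (e ∘ old) a (∀⇒all _ _ λ C C∈Φ → sat (∈ψ-Φ C∈Φ))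
    ; x⇒r = λ i → ⇒₁-sound _ _ (sat (∈ψ-x⇒r i))
    ; y⇒r = λ i → ⇒₁-sound _ _ (sat (∈ψ-y⇒r i))
    ; w⇒r = λ i → ⇒₁-sound _ _ (sat (∈ψ-w⇒r i))
    ; s⇒¬allR = λ s → evalClause-negatives⁻ a (e ∘ vr) (s⇒ (sat ∈ψ-s⇒¬allR) s) }
    where
    sat : ∀ {C} → C ∈ ψ n → evalClause a C ≡ true
    sat = all⇒∀ (evalClause a) h
    s⇒ : ∀ {p q} → not p ∨ q ≡ true → p ≡ true → q ≡ true
    s⇒ h refl = h

  evalCNF-Ψ⁺ : ModelΨ (a ∘ e) → evalCNF a (ψ n) ≡ true
  evalCNF-Ψ⁺ M = ∀⇒all _ (ψ n) λ C → ∈ψ-elim (λ C → evalClause a C ≡ true)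
    (all⇒∀ (evalClause a) (evalCNF-Φ⁺ (e ∘ old) a (ModelΨ.modelΦ M)))
    s⇒¬allR-sat
    (λ i → ⇒₁-complete _ _ (ModelΨ.x⇒r M i))
    (λ i → ⇒₁-complete _ _ (ModelΨ.y⇒r M i))
    (λ i → ⇒₁-complete _ _ (ModelΨ.w⇒r M i))
    where
    s⇒¬allR-sat : evalClause a s⇒¬allR ≡ true
    s⇒¬allR-sat with a (e (old vs)) in s
    ... | false = refl
    ... | true = let i , ri = ModelΨ.s⇒¬allR M s in evalClause-negatives⁺ a (e ∘ vr) i ri

HornClause-negatives : ∀ {k m} (f : Fin k → Fin m) → HornClause (tabulate (λ i → (false , f i)))
HornClause-negatives {zero} f = z≤n
HornClause-negatives {suc k} f = HornClause-negatives (f ∘ Fin.suc)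

Horn-Φ : ∀ {n m} (e : Var n → Fin m) → Horn (Φ.clauses e)
Horn-Φ e C = Φ.∈-elim e HornClause (HornClause-negatives (e ∘ vw)) (λ _ → s≤s z≤n) (λ _ → s≤s z≤n)

Horn-φ : ∀ n → Horn (φ n)
Horn-φ n = Horn-Φ toFin

Horn-ψ : ∀ n → Horn (ψ n)
Horn-ψ n C = ∈ψ-elim HornClause (Horn-Φ (toFin⁺ ∘ old) _) (HornClause-negatives (toFin⁺ {n} ∘ vr))
  (λ _ → s≤s z≤n) (λ _ → s≤s z≤n) (λ _ → s≤s z≤n)

n+n≡2*n : ∀ n → n + n ≡ 2 * n
n+n≡2*n n = cong (n +_) (sym (ℕ.+-identityʳ n))

size-Φ : ∀ {n m} (e : Var n → Fin m) → size (Φ.clauses e) ≡ 1 + 2 * n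
size-Φ {n} e = cong suc (begin
  length (tabulate (Φ.x⇒w e) ++ tabulate (Φ.y⇒w e))  ≡⟨ length-++ (tabulate (Φ.x⇒w e)) ⟩
  length (tabulate (Φ.x⇒w e)) + length (tabulate (Φ.y⇒w e))
    ≡⟨ cong₂ _+_ (length-tabulate (Φ.x⇒w e)) (length-tabulate (Φ.y⇒w e)) ⟩
  n + n                                                ≡⟨ n+n≡2*n n ⟩
  2 * n                                                ∎)
  where open ≡-Reasoning

size-ψ : ∀ n → size (ψ n) ≡ (1 + 2 * n) + (1 + 3 * n)
size-ψ n = begin
  size (ψ n)                                             ≡⟨ length-++ (Φ.clauses (e ∘ old)) ⟩
  size (Φ.clauses (e ∘ old)) + length rClauses           ≡⟨ cong₂ _+_ (size-Φ (e ∘ old)) (cong suc rs) ⟩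
  (1 + 2 * n) + (1 + 3 * n)                              ∎
  where
  open ≡-Reasoning
  open Ψ n
  rs : length (tabulate x⇒r ++ (tabulate y⇒r ++ tabulate w⇒r)) ≡ 3 * n
  rs = begin
    length (tabulate x⇒r ++ (tabulate y⇒r ++ tabulate w⇒r))
      ≡⟨ length-++ (tabulate x⇒r) ⟩
    length (tabulate x⇒r) + length (tabulate y⇒r ++ tabulate w⇒r)
      ≡⟨ cong₂ _+_ (length-tabulate x⇒r) (length-++ (tabulate y⇒r)) ⟩
    n + (length (tabulate y⇒r) + length (tabulate w⇒r))
      ≡⟨ cong (n +_) (cong₂ _+_ (length-tabulate y⇒r) (length-tabulate w⇒r)) ⟩
    n + (n + n)
      ≡⟨ cong (n +_) (n+n≡2*n n) ⟩
    3 * n ∎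

1+k*n≤suc-k*n : ∀ k {n} → 1 ≤ n → 1 + k * n ≤ suc k * n
1+k*n≤suc-k*n k {n} 1≤n = ℕ.+-monoˡ-≤ (k * n) 1≤n

size-φ-≤ : ∀ n → 1 ≤ n → size (φ n) ≤ 3 * n
size-φ-≤ n 1≤n rewrite size-Φ (toFin {n}) = 1+k*n≤suc-k*n 2 1≤n

size-ψ-≤ : ∀ n → 1 ≤ n → size (ψ n) ≤ 7 * n
size-ψ-≤ n 1≤n = begin
  size (ψ n)                 ≡⟨ size-ψ n ⟩
  (1 + 2 * n) + (1 + 3 * n)  ≤⟨ ℕ.+-mono-≤ (1+k*n≤suc-k*n 2 1≤n) (1+k*n≤suc-k*n 3 1≤n) ⟩
  3 * n + 4 * n              ≡⟨ ℕ.*-distribʳ-+ n 3 4 ⟨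
  7 * n                      ∎
  where open ℕ.≤-Reasoning

⇒-false : ∀ {p r} → (p ≡ true → r ≡ true) → r ≡ false → p ≡ false
⇒-false {false} _ _ = refl
⇒-false {true} p⇒r r≡false with trans (sym (p⇒r refl)) r≡false
... | ()

ψ-encodes : ∀ n → IsEncoding (φ n) (ψ n)
ψ-encodes n a = extend , restrict
  where
  A : Var n → Bool
  A = a ∘ toFin {n}
  restrict : (Σ (Assignment n) λ b → evalCNF (a ++ᵛ b) (ψ n) ≡ true) → evalCNF a (φ n) ≡ true
  restrict (b , h) = evalCNF-Φ⁺ (toFin {n}) a (ModelΦ-cong (++-old a b) (ModelΨ.modelΦ (evalCNF-Ψ⁻ (a ++ᵛ b) h)))
  extend : evalCNF a (φ n) ≡ true → Σ (Assignment n) λ b → evalCNF (a ++ᵛ b) (ψ n) ≡ true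
  extend h = r , evalCNF-Ψ⁺ (a ++ᵛ r) model
    where
    open ModelΦ (evalCNF-Φ⁻ (toFin {n}) a h)
    r : Assignment n
    r i = A (vx i) ∨ (A (vy i) ∨ A (vw i))
    r≡ : ∀ i → (a ++ᵛ r) (toFin⁺ (vr i)) ≡ r i
    r≡ = ++-vr a r
    old≡ : ∀ v → (a ++ᵛ r) (toFin⁺ (old v)) ≡ A v
    old≡ = ++-old a r
    model : ModelΨ ((a ++ᵛ r) ∘ toFin⁺)
    model = record
      { modelΦ = ModelΦ-cong (λ v → sym (old≡ v)) (evalCNF-Φ⁻ (toFin {n}) a h)
      ; x⇒r = λ i x → trans (r≡ i) (cong (_∨ (A (vy i) ∨ A (vw i))) (trans (sym (old≡ (vx i))) x))
      ; y⇒r = λ i y → trans (r≡ i) (trans (cong (λ q → A (vx i) ∨ (q ∨ A (vw i))) (trans (sym (old≡ (vy i))) y))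
                                          (∨-zeroʳ (A (vx i))))
      ; w⇒r = λ i w → trans (r≡ i) (trans (cong (λ q → A (vx i) ∨ (A (vy i) ∨ q)) (trans (sym (old≡ (vw i))) w))
                                          (trans (cong (A (vx i) ∨_) (∨-zeroʳ (A (vy i)))) (∨-zeroʳ (A (vx i)))))
      ; s⇒¬allR = λ s′ → let j , wj = ¬allW ; s = trans (sym (old≡ vs)) s′ in
          j , trans (r≡ j) (cong₂ _∨_ (⇒-false (x⇒w j s) wj) (cong₂ _∨_ (⇒-false (y⇒w j s) wj) wj)) }

-- The lower bound

module _ {m} (χ : CNF m) (α : List (Lit m)) (l : Lit m) where

  UnitUnder : Clause m → Set
  UnitUnder A = A ∈ χ × l ∈ A × (∀ k → k ∈ A → k ≡ l ⊎ ∼ k ∈ α)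

  Residue : Clause m → Set
  Residue D = ∃ λ A → A ∈ χ ∧ᵖ α × (∀ k → k ∈ D → k ∈ A) × (∀ k → k ∈ A → k ∈ D ⊎ ∼ k ∈ α)

module _ {m} (χ : CNF m) (α : List (Lit m)) (l : Lit m) (l∉α : l ∉ α)
         (implied⇒ : ∀ k → (χ ∧ᵖ α) ⊨ₗ k → k ∈ α ⊎ k ≡ l) where

  Residue-unit : ∀ {D} → Residue χ α l D → D ≋ (l ∷ []) → ∃ (UnitUnder χ α l)
  Residue-unit (A , A∈ , D⊆A , A⊆D∼α) (D⊆l , l⊆D) = A , A∈χ , l∈A , A⊆l∼α
    where
    l∈A : l ∈ A
    l∈A = D⊆A l (l⊆D l (here refl))
    A∈χ : A ∈ χ
    A∈χ with ∈-∧ᵖ⁻ χ α A∈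
    ... | inj₁ A∈χ = A∈χ
    ... | inj₂ (k , k∈α , refl) with l∈A
    ...   | here refl = ⊥-elim (l∉α k∈α)
    A⊆l∼α : ∀ k → k ∈ A → k ≡ l ⊎ ∼ k ∈ α
    A⊆l∼α k k∈A with A⊆D∼α k k∈A
    ... | inj₂ ∼k∈α = inj₂ ∼k∈α
    ... | inj₁ k∈D with D⊆l k k∈D
    ...   | here k≡l = inj₁ k≡l

  -- Resolving on a literal of α only removes complements of α, so every derived clause stays a
  -- residue of one input clause until the first time l itself is derived.
  UnitDerives-residue : ∀ {D} → UnitDerives (χ ∧ᵖ α) D → ∃ (UnitUnder χ α l) ⊎ Residue χ α l D
  UnitDerives-residue (axiom D∈) = inj₂ (_ , D∈ , (λ k k∈D → k∈D) , (λ k k∈D → inj₁ k∈D))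
  UnitDerives-residue (resolve {C} {D} {k} dC k∈C dD D≋∼k) with UnitDerives-residue dD
  ... | inj₁ found = inj₁ found
  ... | inj₂ resD with implied⇒ (∼ k) (λ a h → trans (sym (∨-identityʳ _)) (⊢₁-sound (D , dD , D≋∼k) a h))
  ...   | inj₂ ∼k≡l = inj₁ (Residue-unit resD (subst (λ j → D ≋ (j ∷ [])) ∼k≡l D≋∼k))
  ...   | inj₁ ∼k∈α with UnitDerives-residue dC
  ...     | inj₁ found = inj₁ found
  ...     | inj₂ (A , A∈ , C⊆A , A⊆C∼α) = inj₂ (A , A∈ , C-k⊆A , A⊆C-k∼α)
    where
    C-k⊆A : ∀ j → j ∈ remove k C → j ∈ A
    C-k⊆A j j∈C-k = C⊆A j (proj₁ (∈-filter⁻ (λ l′ → ¬? (l′ ≟ₗ k)) j∈C-k))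
    A⊆C-k∼α : ∀ j → j ∈ A → j ∈ remove k C ⊎ ∼ j ∈ α
    A⊆C-k∼α j j∈A with A⊆C∼α j j∈A
    ... | inj₂ ∼j∈α = inj₂ ∼j∈α
    ... | inj₁ j∈C with j ≟ₗ k
    ...   | yes refl = inj₂ ∼k∈α
    ...   | no j≢k = inj₁ (∈-filter⁺ (λ l′ → ¬? (l′ ≟ₗ k)) j∈C j≢k)

  ⊢₁-unit⇒UnitUnder : (χ ∧ᵖ α) ⊢₁ (l ∷ []) → ∃ (UnitUnder χ α l)
  ⊢₁-unit⇒UnitUnder (D , dD , D≋l) with UnitDerives-residue dD
  ... | inj₁ found = found
  ... | inj₂ resD = Residue-unit resD D≋l

bit : Fin 2 → Bool
bit Fin.zero = false
bit (Fin.suc _) = true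

bit-injective : ∀ {a b} → bit a ≡ bit b → a ≡ b
bit-injective {Fin.zero} {Fin.zero} _ = refl
bit-injective {Fin.suc Fin.zero} {Fin.suc Fin.zero} _ = refl

funToFin-cong : ∀ {m k} {f g : Fin m → Fin k} → (∀ i → f i ≡ g i) → funToFin f ≡ funToFin g
funToFin-cong {zero} _ = refl
funToFin-cong {suc m} f≗g = cong₂ Fin.combine (f≗g Fin.zero) (funToFin-cong (f≗g ∘ Fin.suc))

finToFun-injective : ∀ {m k} {p q : Fin (k ^ m)} → (∀ i → finToFun {k} {m} p i ≡ finToFun q i) → p ≡ q
finToFun-injective {m} {k} {p} {q} p≗q =
  trans (sym (funToFin-finToFin {m} {k} p)) (trans (funToFin-cong {m} {k} p≗q) (funToFin-finToFin {m} {k} q))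

choose : ∀ {n} → Bool → Fin n → Var n
choose true = vx
choose false = vy

choose-injective : ∀ {n} {b c} {i j : Fin n} → choose b i ≡ choose c j → b ≡ c × i ≡ j
choose-injective {b = true} {true} refl = refl , refl
choose-injective {b = false} {false} refl = refl , refl

choose≢vs : ∀ {n} b (i : Fin n) → ¬ (choose b i ≡ vs)
choose≢vs true i ()
choose≢vs false i ()

choose⇒w : ∀ {n} {A : Var n → Bool} → ModelΦ A → A vs ≡ true → ∀ b i → A (choose b i) ≡ true → A (vw i) ≡ true
choose⇒w M s true i = ModelΦ.x⇒w M i s
choose⇒w M s false i = ModelΦ.y⇒w M i s

offModel : ∀ {n} (X Y W : Fin n → Bool) → Var n → Bool
offModel X Y W vs = false
offModel X Y W (vx i) = X i
offModel X Y W (vy i) = Y i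
offModel X Y W (vw i) = W i

offModel-choose : ∀ {n} (X Y W : Fin n → Bool) b i → (b ≡ true → X i ≡ true) → (b ≡ false → Y i ≡ true) →
  offModel X Y W (choose b i) ≡ true
offModel-choose X Y W true i X-true _ = X-true refl
offModel-choose X Y W false i _ Y-true = Y-true refl

offModel-Φ : ∀ {n} (X Y W : Fin n → Bool) i → W i ≡ false → ModelΦ (offModel X Y W)
offModel-Φ X Y W i Wi = record { x⇒w = λ _ () ; y⇒w = λ _ () ; ¬allW = i , Wi }

onModel : ∀ {n} → Fin n → Var n → Bool
onModel j vs = true
onModel j (vx i) = not (does (i Fin.≟ j))
onModel j (vy i) = not (does (i Fin.≟ j))
onModel j (vw i) = not (does (i Fin.≟ j))

≟-refl-false : ∀ {n} (j : Fin n) → not (does (j Fin.≟ j)) ≡ false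
≟-refl-false j with j Fin.≟ j
... | yes _ = refl
... | no j≢j = ⊥-elim (j≢j refl)

onModel-Φ : ∀ {n} (j : Fin n) → ModelΦ (onModel j)
onModel-Φ j = record { x⇒w = λ _ _ x → x ; y⇒w = λ _ _ y → y ; ¬allW = j , ≟-refl-false j }

onModel-choose : ∀ {n} (j : Fin n) b i → onModel j (choose b i) ≡ not (does (i Fin.≟ j))
onModel-choose j true i = refl
onModel-choose j false i = refl

onModel-¬choose : ∀ {n} (j : Fin n) b i → not (onModel j (choose b i)) ≡ true → i ≡ j
onModel-¬choose j b i ¬u-true rewrite onModel-choose j b i with i Fin.≟ j
... | yes i≡j = i≡j

module LowerBound (n′ : ℕ) (χ : CNF (V (suc (suc n′)))) (pc : PC χ) (φ≡χ : Equivalent (φ (suc (suc n′))) χ) where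

  n : ℕ
  n = suc (suc n′)

  other : Fin n → Fin n
  other Fin.zero = Fin.suc Fin.zero
  other (Fin.suc _) = Fin.zero

  other-≢ : ∀ j → does (other j Fin.≟ j) ≡ false
  other-≢ Fin.zero = refl
  other-≢ (Fin.suc j) = refl

  lift : (Var n → Bool) → Assignment (V n)
  lift A = A ∘ fromFin n

  lift-toFin : ∀ A (v : Var n) → lift A (toFin v) ≡ A v
  lift-toFin A v = cong A (fromFin-toFin v)

  lift-χ : ∀ {A} → ModelΦ A → evalCNF (lift A) χ ≡ true
  lift-χ {A} M = trans (sym (φ≡χ (lift A))) (evalCNF-Φ⁺ toFin (lift A) (ModelΦ-cong (λ v → sym (lift-toFin A v)) M))

  lit : Bool → Var n → Lit (V n)
  lit b v = (b , toFin v)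

  ¬s : Lit (V n)
  ¬s = lit false vs

  module Choice (σ : Fin n → Bool) where

    u : Fin n → Var n
    u i = choose (σ i) i

    α : List (Lit (V n))
    α = tabulate (lit true ∘ u)

    u∈α : ∀ i → lit true (u i) ∈ α
    u∈α = ∈-tabulate⁺ {f = lit true ∘ u}

    α-positive : ∀ {k} → k ∈ α → proj₁ k ≡ true
    α-positive k∈α with ∈-tabulate⁻ {f = lit true ∘ u} k∈α
    ... | _ , refl = refl

    α-consistent : Consistent α
    α-consistent k k∈α ∼k∈α with α-positive k∈α | α-positive ∼k∈α
    ... | k⁺ | ∼k⁺ rewrite k⁺ with ∼k⁺
    ...   | ()

    ¬s∉α : ¬s ∉ α
    ¬s∉α ¬s∈α with α-positive ¬s∈α
    ... | ()

    lift-α : ∀ A → (∀ i → A (u i) ≡ true) → evalCNF (lift A) χ ≡ true → evalCNF (lift A) (χ ∧ᵖ α) ≡ true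
    lift-α A Au Aχ = evalCNF-∧ᵖ⁺ χ α (lift A) Aχ λ k k∈α → α-true (∈-tabulate⁻ {f = lit true ∘ u} k∈α)
      where
      α-true : ∀ {k} → (∃ λ i → k ≡ lit true (u i)) → evalLit (lift A) k ≡ true
      α-true (i , refl) = trans (lift-toFin A (u i)) (Au i)

    refute : ∀ {A} k → ModelΦ A → (∀ i → A (u i) ≡ true) → (χ ∧ᵖ α) ⊨ₗ k → evalLit (lift A) k ≡ false → ⊥
    refute {A} k M Au χα⊨k k-false with trans (sym (χα⊨k (lift A) (lift-α A Au (lift-χ M)))) k-false
    ... | ()

    χα⊨¬s : (χ ∧ᵖ α) ⊨ₗ ¬s
    χα⊨¬s a h with a (toFin {n} vs) in s | evalCNF-∧ᵖ⁻ χ α a h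
    ... | false | _ = refl
    ... | true | aχ , aα with evalCNF-Φ⁻ toFin a (trans (φ≡χ a) aχ)
    ...   | M with ModelΦ.¬allW M
    ...     | j , wj with trans (sym wj) (choose⇒w M s (σ j) j (aα _ (u∈α j)))
    ...       | ()

    noW : Fin n → Bool
    noW _ = false

    allXY : (Fin n → Bool) → Var n → Bool
    allXY = offModel (λ _ → true) (λ _ → true)

    exactlyU : Var n → Bool
    exactlyU = offModel σ (not ∘ σ) (λ _ → false)

    allXY-u : ∀ W j → allXY W (u j) ≡ true
    allXY-u W j = offModel-choose _ _ W (σ j) j (λ _ → refl) (λ _ → refl)

    refuteAllXY : ∀ W i → W i ≡ false → ∀ k → (χ ∧ᵖ α) ⊨ₗ k → evalLit (lift (allXY W)) k ≡ false → ⊥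
    refuteAllXY W i Wi k = refute k (offModel-Φ _ _ W i Wi) (allXY-u W)

    refuteExactlyU : ∀ (i : Fin n) k → (χ ∧ᵖ α) ⊨ₗ k → evalLit (lift exactlyU) k ≡ false → ⊥
    refuteExactlyU i k =
      refute k (offModel-Φ _ _ _ i refl) λ j → offModel-choose σ _ _ (σ j) j (λ σj → σj) (cong not)

    ∈α : ∀ b i → σ i ≡ b → lit true (choose b i) ∈ α
    ∈α b i σi≡b = subst (λ b → lit true (choose b i) ∈ α) σi≡b (u∈α i)

    -- Every literal outside α ∪ {¬s} is refuted by a model of φ n ∧ α.
    implied⇒-var : ∀ b (v : Var n) → (χ ∧ᵖ α) ⊨ₗ lit b v → lit b v ∈ α ⊎ lit b v ≡ ¬s
    implied⇒-var true vs ⊨s =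
      ⊥-elim (refuteAllXY noW Fin.zero refl (lit true vs) ⊨s (lift-toFin (allXY noW) vs))
    implied⇒-var true (vw i) ⊨w =
      ⊥-elim (refuteAllXY noW i refl (lit true (vw i)) ⊨w (lift-toFin (allXY noW) (vw i)))
    implied⇒-var true (vx i) ⊨x with σ i in σi
    ... | true = inj₁ (∈α true i σi)
    ... | false = ⊥-elim (refuteExactlyU i (lit true (vx i)) ⊨x (trans (lift-toFin exactlyU (vx i)) σi))
    implied⇒-var true (vy i) ⊨y with σ i in σi
    ... | false = inj₁ (∈α false i σi)
    ... | true = ⊥-elim (refuteExactlyU i (lit true (vy i)) ⊨y (trans (lift-toFin exactlyU (vy i)) (cong not σi)))
    implied⇒-var false vs _ = inj₂ refl
    implied⇒-var false (vx i) ⊨¬x =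
      ⊥-elim (refuteAllXY noW i refl (lit false (vx i)) ⊨¬x (cong not (lift-toFin (allXY noW) (vx i))))
    implied⇒-var false (vy i) ⊨¬y =
      ⊥-elim (refuteAllXY noW i refl (lit false (vy i)) ⊨¬y (cong not (lift-toFin (allXY noW) (vy i))))
    implied⇒-var false (vw i) ⊨¬w =
      ⊥-elim (refuteAllXY onlyW (other i) (other-≢ i) (lit false (vw i)) ⊨¬w
        (trans (cong not (lift-toFin (allXY onlyW) (vw i))) (≟-refl-false i)))
      where
      onlyW : Fin n → Bool
      onlyW j = does (j Fin.≟ i)

    implied⇒ : ∀ k → (χ ∧ᵖ α) ⊨ₗ k → k ∈ α ⊎ k ≡ ¬s
    implied⇒ (b , j) ⊨k = subst (λ j → (b , j) ∈ α ⊎ (b , j) ≡ ¬s) (toFin-fromFin j)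
      (implied⇒-var b (fromFin n j) (subst (λ j → (χ ∧ᵖ α) ⊨ₗ (b , j)) (sym (toFin-fromFin j)) ⊨k))

    ⊢₁¬s : (χ ∧ᵖ α) ⊢₁ (¬s ∷ [])
    ⊢₁¬s with pc α α-consistent ¬s χα⊨¬s
    ... | inj₁ ⊢¬s = ⊢¬s
    ... | inj₂ ⊢⊥ with ⊢₁-sound ⊢⊥ _ (lift-α (allXY noW) (allXY-u noW) (lift-χ (offModel-Φ _ _ noW Fin.zero refl)))
    ...   | ()

    -- At onModel i the literal ¬s and all ¬u j with j ≢ i are false, so ¬u i has to occur.
    UnitUnder-∋¬u : ∀ {A} → UnitUnder χ α ¬s A → ∀ i → lit false (u i) ∈ A
    UnitUnder-∋¬u {A} (A∈χ , _ , A⊆) i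
      with any⇒∃ (evalLit (lift (onModel i))) A (all⇒∀ _ (lift-χ (onModel-Φ i)) A∈χ)
    ... | k , k∈A , k-true with A⊆ k k∈A
    ...   | inj₁ refl with trans (sym k-true) (cong not (lift-toFin (onModel i) vs))
    ...     | ()
    UnitUnder-∋¬u {A} _ i | k , k∈A , k-true | inj₂ ∼k∈α with ∈-tabulate⁻ {f = lit true ∘ u} ∼k∈α
    ... | j , ∼k≡ = subst (λ j → lit false (u j) ∈ A) j≡i (subst (_∈ A) k≡ k∈A)
      where
      k≡ : k ≡ lit false (u j)
      k≡ = trans (sym (∼-involutive k)) (cong ∼_ ∼k≡)
      j≡i : j ≡ i
      j≡i = onModel-¬choose i (σ j) j
        (trans (cong not (sym (lift-toFin (onModel i) (u j)))) (trans (cong (evalLit _) (sym k≡)) k-true))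

    clause : ∃ λ A → UnitUnder χ α ¬s A × (∀ i → lit false (u i) ∈ A)
    clause = let A , unit = ⊢₁-unit⇒UnitUnder χ α ¬s ¬s∉α implied⇒ ⊢₁¬s in A , unit , UnitUnder-∋¬u unit

  choice-determined : ∀ σ τ {A} → (∀ i → lit false (Choice.u σ i) ∈ A) → UnitUnder χ (Choice.α τ) ¬s A →
    ∀ i → σ i ≡ τ i
  choice-determined σ τ ∋¬u (_ , _ , A⊆) i with A⊆ _ (∋¬u i)
  ... | inj₁ ¬u≡¬s = ⊥-elim (choose≢vs (σ i) i (toFin-injective (cong proj₂ ¬u≡¬s)))
  ... | inj₂ u∈ατ with ∈-tabulate⁻ {f = lit true ∘ Choice.u τ} u∈ατ
  ...   | j , u≡ with choose-injective (toFin-injective (cong proj₂ u≡))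
  ...     | σi≡τj , refl = σi≡τj

  clauseIndex : Fin (2 ^ n) → Fin (size χ)
  clauseIndex p = Any.index (proj₁ (proj₁ (proj₂ (Choice.clause (bit ∘ finToFun p)))))

  clauseIndex-injective : ∀ {p q} → clauseIndex p ≡ clauseIndex q → p ≡ q
  clauseIndex-injective {p} {q} same-index = finToFun-injective λ i →
    bit-injective (choice-determined σ τ (proj₂ (proj₂ (Choice.clause σ)))
                                        (subst (UnitUnder χ (Choice.α τ) ¬s) B≡A unitB) i)
    where
    σ τ : Fin n → Bool
    σ = bit ∘ finToFun p
    τ = bit ∘ finToFun q
    A B : Clause (V n)
    A = proj₁ (Choice.clause σ)
    B = proj₁ (Choice.clause τ)
    unitA : UnitUnder χ (Choice.α σ) ¬s A
    unitA = proj₁ (proj₂ (Choice.clause σ))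
    unitB : UnitUnder χ (Choice.α τ) ¬s B
    unitB = proj₁ (proj₂ (Choice.clause τ))
    B≡A : B ≡ A
    B≡A = trans (lookup-index (proj₁ unitB)) (trans (cong (lookup χ) (sym same-index)) (sym (lookup-index (proj₁ unitA))))

  2^n≤size : 2 ^ n ≤ size χ
  2^n≤size = injective⇒≤ clauseIndex-injective

-- Propagation completeness of ψₙ

module _ {A : Set} {P : A → Set} (P? : ∀ x → Dec (P x)) where

  filter-2≤-pair : ∀ a b → 2 ≤ length (filter P? (a ∷ b ∷ [])) → P a × P b
  filter-2≤-pair a b with P? a
  ... | no _ = λ h → ⊥-elim (ℕ.<⇒≱ h (length-filter P? (b ∷ [])))
  ... | yes pa with P? b
  ...   | yes pb = λ _ → pa , pb
  ...   | no _ = λ { (s≤s ()) }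

  filter-2≤-triple : ∀ a b c → 2 ≤ length (filter P? (a ∷ b ∷ c ∷ [])) →
    (P a × P b) ⊎ (P a × P c) ⊎ (P b × P c)
  filter-2≤-triple a b c with P? a
  ... | yes pa with P? b
  ...   | yes pb = λ _ → inj₁ (pa , pb)
  ...   | no _ with P? c
  ...     | yes pc = λ _ → inj₂ (inj₁ (pa , pc))
  ...     | no _ = λ { (s≤s ()) }
  filter-2≤-triple a b c | no _ with P? b
  ...   | no _ = λ h → ⊥-elim (ℕ.<⇒≱ h (length-filter P? (c ∷ [])))
  ...   | yes pb with P? c
  ...     | yes pc = λ _ → inj₂ (inj₂ (pb , pc))
  ...     | no _ = λ { (s≤s ()) }

  filter-1≤-tabulate : ∀ {k} (f : Fin k → A) → 1 ≤ length (filter P? (tabulate f)) → ∃ λ i → P (f i)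
  filter-1≤-tabulate {suc k} f with P? (f Fin.zero)
  ... | yes p = λ _ → Fin.zero , p
  ... | no _ = λ h → let i , p = filter-1≤-tabulate (f ∘ Fin.suc) h in Fin.suc i , p

  filter-2≤-tabulate : ∀ {k} (f : Fin k → A) → 2 ≤ length (filter P? (tabulate f)) →
    ∃ λ i → ∃ λ j → ¬ (i ≡ j) × P (f i) × P (f j)
  filter-2≤-tabulate {suc k} f with P? (f Fin.zero)
  ... | yes p = λ h → let i , q = filter-1≤-tabulate (f ∘ Fin.suc) (ℕ.≤-pred h) in Fin.zero , Fin.suc i , (λ ()) , p , q
  ... | no _ = λ h → let i , j , i≢j , p , q = filter-2≤-tabulate (f ∘ Fin.suc) h in
                     Fin.suc i , Fin.suc j , (λ si≡sj → i≢j (suc-injective si≡sj)) , p , q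

  filter-2≤-∷ : ∀ a xs → 2 ≤ length (filter P? (a ∷ xs)) →
    1 ≤ length (filter P? xs) × (¬ P a → 2 ≤ length (filter P? xs))
  filter-2≤-∷ a xs with P? a
  ... | yes pa = λ h → ℕ.≤-pred h , λ ¬pa → ⊥-elim (¬pa pa)
  ... | no _ = λ h → ℕ.≤-trans (s≤s z≤n) h , λ _ → h

Open : ∀ {m} → List (Lit m) → Lit m → Set
Open S k = ∼ k ∉ S

module _ {m} {S : List (Lit m)} where

  open? : ∀ k → Dec (Open S k)
  open? k = ¬? (∼ k ∈? S)

  Quiet-pair : ∀ a b → Quiet S (a ∷ b ∷ []) → a ∈ S ⊎ b ∈ S ⊎ (Open S a × Open S b)
  Quiet-pair a b (inj₁ (here a∈S)) = inj₁ a∈S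
  Quiet-pair a b (inj₁ (there (here b∈S))) = inj₂ (inj₁ b∈S)
  Quiet-pair a b (inj₂ two) = inj₂ (inj₂ (filter-2≤-pair open? a b two))

  QuietTriple : Lit m → Lit m → Lit m → Set
  QuietTriple a b c = a ∈ S ⊎ b ∈ S ⊎ c ∈ S ⊎ (Open S a × Open S b) ⊎ (Open S a × Open S c) ⊎ (Open S b × Open S c)

  Quiet-triple : ∀ a b c → Quiet S (a ∷ b ∷ c ∷ []) → QuietTriple a b c
  Quiet-triple a b c (inj₁ (here a∈S)) = inj₁ a∈S
  Quiet-triple a b c (inj₁ (there (here b∈S))) = inj₂ (inj₁ b∈S)
  Quiet-triple a b c (inj₁ (there (there (here c∈S)))) = inj₂ (inj₂ (inj₁ c∈S))
  Quiet-triple a b c (inj₂ two) = inj₂ (inj₂ (inj₂ (filter-2≤-triple open? a b c two)))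

  TwoOpen : ∀ {k} → (Fin k → Lit m) → Set
  TwoOpen f = ∃ λ i → ∃ λ j → ¬ (i ≡ j) × Open S (f i) × Open S (f j)

  ∈-tabulate-S : ∀ {k} (f : Fin k → Lit m) → Any (_∈ S) (tabulate f) → ∃ λ i → f i ∈ S
  ∈-tabulate-S f f∈S with find f∈S
  ... | k , k∈ , k∈S with ∈-tabulate⁻ {f = f} k∈
  ...   | i , refl = i , k∈S

  Quiet-tabulate : ∀ {k} (f : Fin k → Lit m) → Quiet S (tabulate f) → (∃ λ i → f i ∈ S) ⊎ TwoOpen f
  Quiet-tabulate f (inj₁ f∈S) = inj₁ (∈-tabulate-S f f∈S)
  Quiet-tabulate f (inj₂ two) = inj₂ (filter-2≤-tabulate open? f two)

  Quiet-∷-tabulate : ∀ {k} a (f : Fin k → Lit m) → Quiet S (a ∷ tabulate f) →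
    a ∈ S ⊎ (∃ λ i → f i ∈ S) ⊎ ((∃ λ i → Open S (f i)) × (∼ a ∈ S → TwoOpen f))
  Quiet-∷-tabulate a f (inj₁ (here a∈S)) = inj₁ a∈S
  Quiet-∷-tabulate a f (inj₁ (there f∈S)) = inj₂ (inj₁ (∈-tabulate-S f f∈S))
  Quiet-∷-tabulate a f (inj₂ two) with filter-2≤-∷ open? a (tabulate f) two
  ... | one , two′ = inj₂ (inj₂ (filter-1≤-tabulate open? f one ,
                                 λ ∼a∈S → filter-2≤-tabulate open? f (two′ (λ ∼a∉S → ∼a∉S ∼a∈S))))

module Override {m} (S : List (Lit m)) (consistent : Consistent S) (t : Fin m) (d : Assignment m) where

  M : Assignment m
  M j with (true , j) ∈? S | (false , j) ∈? S | j Fin.≟ t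
  ... | yes _ | _ | _ = true
  ... | no _ | yes _ | _ = false
  ... | no _ | no _ | yes _ = true
  ... | no _ | no _ | no _ = d j

  M-pos : ∀ {j} → (true , j) ∈ S → M j ≡ true
  M-pos {j} j∈S with (true , j) ∈? S
  ... | yes _ = refl
  ... | no j∉S = ⊥-elim (j∉S j∈S)

  M-neg : ∀ {j} → (false , j) ∈ S → M j ≡ false
  M-neg {j} ¬j∈S with (true , j) ∈? S | (false , j) ∈? S
  ... | yes j∈S | _ = ⊥-elim (consistent _ ¬j∈S j∈S)
  ... | no _ | yes _ = refl
  ... | no _ | no ¬j∉S = ⊥-elim (¬j∉S ¬j∈S)

  M-t : (true , t) ∉ S → (false , t) ∉ S → M t ≡ true
  M-t t∉S ¬t∉S with (true , t) ∈? S | (false , t) ∈? S | t Fin.≟ t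
  ... | yes t∈S | _ | _ = ⊥-elim (t∉S t∈S)
  ... | no _ | yes ¬t∈S | _ = ⊥-elim (¬t∉S ¬t∈S)
  ... | no _ | no _ | yes _ = refl
  ... | no _ | no _ | no t≢t = ⊥-elim (t≢t refl)

  M-default : ∀ {j} → (true , j) ∉ S → (false , j) ∉ S → ¬ (j ≡ t) → M j ≡ d j
  M-default {j} j∉S ¬j∉S j≢t with (true , j) ∈? S | (false , j) ∈? S | j Fin.≟ t
  ... | yes j∈S | _ | _ = ⊥-elim (j∉S j∈S)
  ... | no _ | yes ¬j∈S | _ = ⊥-elim (¬j∉S ¬j∈S)
  ... | no _ | no _ | yes j≡t = ⊥-elim (j≢t j≡t)
  ... | no _ | no _ | no _ = refl

  M-true⁻ : ∀ {j} → M j ≡ true → (true , j) ∉ S → j ≡ t ⊎ d j ≡ true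
  M-true⁻ {j} Mj j∉S with (true , j) ∈? S | (false , j) ∈? S | j Fin.≟ t
  ... | yes j∈S | _ | _ = ⊥-elim (j∉S j∈S)
  ... | no _ | no _ | yes j≡t = inj₁ j≡t
  ... | no _ | no _ | no _ = inj₂ Mj

  M-false⁻ : ∀ {j} → M j ≡ false → (false , j) ∉ S → (true , j) ∉ S × ¬ (j ≡ t) × d j ≡ false
  M-false⁻ {j} Mj ¬j∉S with (true , j) ∈? S | (false , j) ∈? S | j Fin.≟ t
  ... | no _ | yes ¬j∈S | _ = ⊥-elim (¬j∉S ¬j∈S)
  ... | no j∉S | no _ | no j≢t = j∉S , j≢t , Mj

  M-lits : ∀ k → k ∈ S → evalLit M k ≡ true
  M-lits (true , j) j∈S = M-pos j∈S
  M-lits (false , j) ¬j∈S = cong not (M-neg ¬j∈S)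

index : ∀ {n} → Var⁺ n → Maybe (Fin n)
index (old vs) = nothing
index (old (vx i)) = just i
index (old (vy i)) = just i
index (old (vw i)) = just i
index (vr i) = just i

spared : ∀ {n} → Maybe (Fin n) → Fin n → Bool
spared nothing i = true
spared (just k) i = not (does (i Fin.≟ k))

spared-false : ∀ {n} (K : Maybe (Fin n)) i → spared K i ≡ false → K ≡ just i
spared-false (just k) i h with i Fin.≟ k
... | yes refl = refl

spared-self : ∀ {n} (k : Fin n) → spared (just k) k ≡ false
spared-self = ≟-refl-false

-- Values of the variables that neither S nor t constrains.
default : ∀ {n} → Maybe (Fin n) → Var⁺ n → Bool
default K (old vs) = false
default K (old (vx _)) = false
default K (old (vy _)) = false
default K (old (vw i)) = spared K i
default K (vr i) = spared K i

avoid : ∀ {n} {i j : Fin n} → ¬ (i ≡ j) → (b : Maybe (Fin n)) → ∃ λ k → (k ≡ i ⊎ k ≡ j) × ¬ (b ≡ just k)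
avoid {i = i} i≢j nothing = i , inj₁ refl , λ ()
avoid {i = i} {j} i≢j (just c) with c Fin.≟ i
... | yes refl = j , inj₂ refl , λ c≡j → i≢j (just-injective c≡j)
... | no c≢i = i , inj₁ refl , λ c≡i → c≢i (just-injective c≡i)

module FreeExtension (n : ℕ) (S : List (Lit (V n + n))) (stable : Stable (ψ n) S) (consistent : Consistent S)
                     (t : Fin (V n + n)) (t∉S : (true , t) ∉ S) (¬t∉S : (false , t) ∉ S) where
  open Ψ n

  S⁺ S⁻ : Var⁺ n → Set
  S⁺ v = (true , e v) ∈ S
  S⁻ v = (false , e v) ∈ S

  S±-clash : ∀ {v} → S⁺ v → S⁻ v → ⊥
  S±-clash {v} = consistent (true , e v)

  vt : Var⁺ n
  vt = fromFin⁺ n t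

  vt-unique : ∀ {v} → e v ≡ t → vt ≡ v
  vt-unique {v} ev≡t = trans (cong (fromFin⁺ n) (sym ev≡t)) (fromFin⁺-toFin⁺ v)

  S⁻-free : ∀ v → S⁻ v → ¬ (e v ≡ t)
  S⁻-free v ¬v∈S ev≡t = ¬t∉S (subst (λ j → (false , j) ∈ S) ev≡t ¬v∈S)

  -- s is true in every model extending S with t true.
  sOn : Set
  sOn = S⁺ (old vs) ⊎ e (old vs) ≡ t

  sOn? : Dec sOn
  sOn? with (true , e (old vs)) ∈? S
  ... | yes s∈S = yes (inj₁ s∈S)
  ... | no s∉S with e (old vs) Fin.≟ t
  ...   | yes s≡t = yes (inj₂ s≡t)
  ...   | no s≢t = no λ { (inj₁ s∈S) → s∉S s∈S ; (inj₂ s≡t) → s≢t s≡t }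

  quiet-x⇒w : ∀ i → Quiet S (Φ.x⇒w (e ∘ old) i)
  quiet-x⇒w i = stable _ (∈ψ-Φ (Φ.∈-x⇒w (e ∘ old) i))
  quiet-y⇒w : ∀ i → Quiet S (Φ.y⇒w (e ∘ old) i)
  quiet-y⇒w i = stable _ (∈ψ-Φ (Φ.∈-y⇒w (e ∘ old) i))
  quiet-¬allW : Quiet S (Φ.¬allW (e ∘ old))
  quiet-¬allW = stable _ (∈ψ-Φ (Φ.∈-¬allW (e ∘ old)))
  quiet-s⇒¬allR : Quiet S s⇒¬allR
  quiet-s⇒¬allR = stable _ ∈ψ-s⇒¬allR
  quiet-x⇒r : ∀ i → Quiet S (x⇒r i)
  quiet-x⇒r i = stable _ (∈ψ-x⇒r i)
  quiet-y⇒r : ∀ i → Quiet S (y⇒r i)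
  quiet-y⇒r i = stable _ (∈ψ-y⇒r i)
  quiet-w⇒r : ∀ i → Quiet S (w⇒r i)
  quiet-w⇒r i = stable _ (∈ψ-w⇒r i)

  module _ (v : Var⁺ n) {i} (quiet : Quiet S (neg e v ∷ pos e (vr i) ∷ [])) where

    ⇒r-S⁻ : S⁻ (vr i) → S⁻ v
    ⇒r-S⁻ ¬r∈S with Quiet-pair _ _ quiet
    ... | inj₁ ¬v∈S = ¬v∈S
    ... | inj₂ (inj₁ r∈S) = ⊥-elim (S±-clash {vr i} r∈S ¬r∈S)
    ... | inj₂ (inj₂ (_ , ¬r∉S)) = ⊥-elim (¬r∉S ¬r∈S)

    ⇒r-S⁺ : S⁺ v → S⁺ (vr i)
    ⇒r-S⁺ v∈S with Quiet-pair _ _ quiet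
    ... | inj₁ ¬v∈S = ⊥-elim (S±-clash {v} v∈S ¬v∈S)
    ... | inj₂ (inj₁ r∈S) = r∈S
    ... | inj₂ (inj₂ (v∉S , _)) = ⊥-elim (v∉S v∈S)

  r⁻⇒index⁻ : ∀ {i} → S⁻ (vr i) → ∀ v → index v ≡ just i → S⁻ v
  r⁻⇒index⁻ ¬r∈S (old (vx j)) refl = ⇒r-S⁻ (old (vx j)) (quiet-x⇒r j) ¬r∈S
  r⁻⇒index⁻ ¬r∈S (old (vy j)) refl = ⇒r-S⁻ (old (vy j)) (quiet-y⇒r j) ¬r∈S
  r⁻⇒index⁻ ¬r∈S (old (vw j)) refl = ⇒r-S⁻ (old (vw j)) (quiet-w⇒r j) ¬r∈S
  r⁻⇒index⁻ ¬r∈S (vr j) refl = ¬r∈S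

  -- The index K at which w and r default to false, which makes ¬allW and s ⇒ ¬allR true: neither S nor t
  -- may force w_K, nor r_K when s is on.  If s stays off, a w falsified by S does the job (K = nothing).
  Sacrifice : Maybe (Fin n) → Set
  Sacrifice nothing = (∃ λ j → S⁻ (old (vw j))) × ¬ sOn
  Sacrifice (just k) = ¬ S⁺ (old (vw k)) × ¬ (index vt ≡ just k) × (sOn → ¬ S⁺ (vr k))

  sacrifice-¬r : ∀ i → S⁻ (vr i) → Sacrifice (just i)
  sacrifice-¬r i ¬r∈S =
    (λ w∈S → S±-clash {old (vw i)} w∈S (r⁻⇒index⁻ ¬r∈S (old (vw i)) refl)) ,
    (λ vt-i → S⁻-free vt (r⁻⇒index⁻ ¬r∈S vt vt-i) (toFin⁺-fromFin⁺ t)) ,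
    (λ _ r∈S → S±-clash {vr i} r∈S ¬r∈S)

  sacrifice-r∉S : ∀ k → ¬ S⁺ (vr k) → ¬ (index vt ≡ just k) → Sacrifice (just k)
  sacrifice-r∉S k r∉S vt-k = (λ w∈S → r∉S (⇒r-S⁺ (old (vw k)) (quiet-w⇒r k) w∈S)) , vt-k , λ _ → r∉S

  sacrifice-sOn : (∀ i → ¬ S⁻ (vr i)) → sOn → ∃ Sacrifice
  sacrifice-sOn no¬r son with Quiet-∷-tabulate (neg e (old vs)) (neg e ∘ vr) quiet-s⇒¬allR | son
  ... | inj₁ ¬s∈S | inj₁ s∈S = ⊥-elim (S±-clash {old vs} s∈S ¬s∈S)
  ... | inj₁ ¬s∈S | inj₂ s≡t = ⊥-elim (S⁻-free (old vs) ¬s∈S s≡t)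
  ... | inj₂ (inj₁ (i , ¬r∈S)) | _ = ⊥-elim (no¬r i ¬r∈S)
  ... | inj₂ (inj₂ (_ , two)) | inj₁ s∈S with two s∈S
  ...   | i , j , i≢j , r∉S , r′∉S with avoid i≢j (index vt)
  ...     | k , inj₁ refl , vt-k = just k , sacrifice-r∉S k r∉S vt-k
  ...     | k , inj₂ refl , vt-k = just k , sacrifice-r∉S k r′∉S vt-k
  sacrifice-sOn no¬r son | inj₂ (inj₂ ((i , r∉S) , _)) | inj₂ s≡t = just i , sacrifice-r∉S i r∉S vt-i
    where
    vt-i : ¬ (index vt ≡ just i)
    vt-i vt-i′ with trans (sym (cong index (vt-unique {old vs} s≡t))) vt-i′
    ... | ()

  sacrifice-sOff : ¬ sOn → ∃ Sacrifice
  sacrifice-sOff ¬son with any? (λ j → (false , e (old (vw j))) ∈? S)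
  ... | yes ¬w = nothing , ¬w , ¬son
  ... | no no¬w with Quiet-tabulate (neg e ∘ old ∘ vw) quiet-¬allW
  ...   | inj₁ ¬w = ⊥-elim (no¬w ¬w)
  ...   | inj₂ (i , j , i≢j , w∉S , w′∉S) with avoid i≢j (index vt)
  ...     | k , inj₁ refl , vt-k = just k , w∉S , vt-k , λ son → ⊥-elim (¬son son)
  ...     | k , inj₂ refl , vt-k = just k , w′∉S , vt-k , λ son → ⊥-elim (¬son son)

  sacrifice : ∃ Sacrifice
  sacrifice with any? (λ i → (false , e (vr i)) ∈? S)
  ... | yes (i , ¬r∈S) = just i , sacrifice-¬r i ¬r∈S
  ... | no no¬r with sOn?
  ...   | yes son = sacrifice-sOn (λ i ¬r∈S → no¬r (i , ¬r∈S)) son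
  ...   | no ¬son = sacrifice-sOff ¬son

  module Model (K : Maybe (Fin n)) (sac : Sacrifice K) where
    open Override S consistent t (default K ∘ fromFin⁺ n)

    default-e : ∀ v → default K (fromFin⁺ n (e v)) ≡ default K v
    default-e v = cong (default K) (fromFin⁺-toFin⁺ v)

    M-off : ∀ v → ¬ S⁺ v → ¬ S⁻ v → ¬ (e v ≡ t) → M (e v) ≡ default K v
    M-off v v∉S ¬v∉S v≢t = trans (M-default v∉S ¬v∉S v≢t) (default-e v)

    M-on⁻ : ∀ v → M (e v) ≡ true → ¬ S⁺ v → e v ≡ t ⊎ default K v ≡ true
    M-on⁻ v Mv v∉S with M-true⁻ Mv v∉S
    ... | inj₁ v≡t = inj₁ v≡t
    ... | inj₂ dv = inj₂ (trans (sym (default-e v)) dv)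

    M-on⇒t : ∀ v → M (e v) ≡ true → ¬ S⁺ v → default K v ≡ false → e v ≡ t
    M-on⇒t v Mv v∉S dv with M-on⁻ v Mv v∉S
    ... | inj₁ v≡t = v≡t
    ... | inj₂ dv′ with trans (sym dv′) dv
    ...   | ()

    M-off⁻ : ∀ v → M (e v) ≡ false → ¬ S⁻ v → ¬ S⁺ v × ¬ (e v ≡ t) × default K v ≡ false
    M-off⁻ v Mv ¬v∉S with M-false⁻ Mv ¬v∉S
    ... | v∉S , v≢t , dv = v∉S , v≢t , trans (sym (default-e v)) dv

    sacrificed : ∀ {i} → K ≡ just i → Sacrifice (just i)
    sacrificed refl = sac

    sacrifice-view : (K ≡ nothing × Sacrifice nothing) ⊎ (∃ λ k → K ≡ just k × Sacrifice (just k))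
    sacrifice-view = view K sac refl
      where
      view : ∀ K′ → Sacrifice K′ → K ≡ K′ →
             (K ≡ nothing × Sacrifice nothing) ⊎ (∃ λ k → K ≡ just k × Sacrifice (just k))
      view nothing sac′ K≡ = inj₁ (K≡ , sac′)
      view (just k) sac′ K≡ = inj₂ (k , K≡ , sac′)

    M-sOn : M (e (old vs)) ≡ true → sOn
    M-sOn Ms = by-S⁺ ((true , e (old vs)) ∈? S)
      where
      by-S⁺ : Dec (S⁺ (old vs)) → sOn
      by-S⁺ (yes s∈S) = inj₁ s∈S
      by-S⁺ (no s∉S) = inj₂ (M-on⇒t (old vs) Ms s∉S refl)

    M-sacrificed : ∀ v {k} → K ≡ just k → index v ≡ just k → default K v ≡ spared K k → ¬ S⁺ v →
                   ¬ (index vt ≡ just k) → M (e v) ≡ false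
    M-sacrificed v {k} refl v-k dv v∉S vt-k = by-S⁻ ((false , e v) ∈? S)
      where
      by-S⁻ : Dec (S⁻ v) → M (e v) ≡ false
      by-S⁻ (yes ¬v∈S) = M-neg ¬v∈S
      by-S⁻ (no ¬v∉S) = trans (M-off v v∉S ¬v∉S λ v≡t → vt-k (trans (cong index (vt-unique {v} v≡t)) v-k))
                              (trans dv (spared-self k))

    ¬allW-holds : ∃ λ i → M (e (old (vw i))) ≡ false
    ¬allW-holds with sacrifice-view
    ... | inj₁ (_ , (j , ¬w∈S) , _) = j , M-neg ¬w∈S
    ... | inj₂ (k , K≡k , w∉S , vt-k , _) = k , M-sacrificed (old (vw k)) K≡k refl refl w∉S vt-k

    s⇒¬allR-holds : M (e (old vs)) ≡ true → ∃ λ i → M (e (vr i)) ≡ false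
    s⇒¬allR-holds Ms with sacrifice-view
    ... | inj₁ (_ , _ , ¬son) = ⊥-elim (¬son (M-sOn Ms))
    ... | inj₂ (k , K≡k , _ , vt-k , son⇒r∉S) = k , M-sacrificed (vr k) K≡k refl refl (son⇒r∉S (M-sOn Ms)) vt-k

    ⇒r-holds : ∀ v i → index v ≡ just i → (default K v ≡ true → spared K i ≡ true) →
      Quiet S (neg e v ∷ pos e (vr i) ∷ []) → M (e v) ≡ true → M (e (vr i)) ≡ true
    ⇒r-holds v i v-i dv⇒ quiet Mv with M (e (vr i)) in Mr
    ... | true = refl
    ... | false with Quiet-pair _ _ quiet
    ...   | inj₁ ¬v∈S with trans (sym Mv) (M-neg ¬v∈S)
    ...     | ()
    ⇒r-holds v i v-i dv⇒ quiet Mv | false | inj₂ (inj₁ r∈S) with trans (sym Mr) (M-pos r∈S)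
    ...     | ()
    ⇒r-holds v i v-i dv⇒ quiet Mv | false | inj₂ (inj₂ (v∉S , ¬r∉S)) with M-off⁻ (vr i) Mr ¬r∉S
    ... | _ , _ , dr with M-on⁻ v Mv v∉S
    ...   | inj₁ v≡t =
      ⊥-elim (proj₁ (proj₂ (sacrificed (spared-false K i dr))) (trans (cong index (vt-unique {v} v≡t)) v-i))
    ...   | inj₂ dv with trans (sym (dv⇒ dv)) dr
    ...     | ()

    ⇒w-holds : ∀ v i → index (old v) ≡ just i → default K (old v) ≡ false → ¬ (v ≡ vs) →
      Quiet S (neg e (old vs) ∷ neg e (old v) ∷ pos e (old (vw i)) ∷ []) → Quiet S (neg e (old v) ∷ pos e (vr i) ∷ []) →
      M (e (old vs)) ≡ true → M (e (old v)) ≡ true → M (e (old (vw i))) ≡ true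
    ⇒w-holds v i v-i dv v≢s quiet₃ quiet₂ Ms Mv with M (e (old (vw i))) in Mw
    ... | true = refl
    ... | false = ⊥-elim (refuted (Quiet-triple _ _ _ quiet₃))
      where
      s≡t : ¬ S⁺ (old vs) → e (old vs) ≡ t
      s≡t s∉S = M-on⇒t (old vs) Ms s∉S refl
      v≡t : ¬ S⁺ (old v) → e (old v) ≡ t
      v≡t v∉S = M-on⇒t (old v) Mv v∉S dv
      not-both-t : e (old vs) ≡ t → e (old v) ≡ t → ⊥
      not-both-t s≡t′ v≡t′ = v≢s (old-injective (toFin⁺-injective (trans v≡t′ (sym s≡t′))))
      w-sacrificed : ¬ S⁻ (old (vw i)) → Sacrifice (just i)
      w-sacrificed ¬w∉S = sacrificed (spared-false K i (proj₂ (proj₂ (M-off⁻ (old (vw i)) Mw ¬w∉S))))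
      refuted : QuietTriple {S = S} (neg e (old vs)) (neg e (old v)) (pos e (old (vw i))) → ⊥
      refuted (inj₁ ¬s∈S) with trans (sym Ms) (M-neg ¬s∈S)
      ... | ()
      refuted (inj₂ (inj₁ ¬v∈S)) with trans (sym Mv) (M-neg ¬v∈S)
      ... | ()
      refuted (inj₂ (inj₂ (inj₁ w∈S))) with trans (sym Mw) (M-pos w∈S)
      ... | ()
      refuted (inj₂ (inj₂ (inj₂ (inj₁ (s∉S , v∉S))))) = not-both-t (s≡t s∉S) (v≡t v∉S)
      refuted (inj₂ (inj₂ (inj₂ (inj₂ (inj₁ (s∉S , ¬w∉S)))))) = by-v ((true , e (old v)) ∈? S)
        where
        by-v : Dec (S⁺ (old v)) → ⊥
        by-v (yes v∈S) = proj₂ (proj₂ (w-sacrificed ¬w∉S)) (inj₂ (s≡t s∉S)) (⇒r-S⁺ (old v) quiet₂ v∈S)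
        by-v (no v∉S) = not-both-t (s≡t s∉S) (v≡t v∉S)
      refuted (inj₂ (inj₂ (inj₂ (inj₂ (inj₂ (v∉S , ¬w∉S)))))) =
        proj₁ (proj₂ (w-sacrificed ¬w∉S)) (trans (cong index (vt-unique {old v} (v≡t v∉S))) v-i)

    model : ModelΨ (M ∘ e)
    model = record
      { modelΦ = record
        { x⇒w = λ i → ⇒w-holds (vx i) i refl refl (λ ()) (quiet-x⇒w i) (quiet-x⇒r i)
        ; y⇒w = λ i → ⇒w-holds (vy i) i refl refl (λ ()) (quiet-y⇒w i) (quiet-y⇒r i)
        ; ¬allW = ¬allW-holds }
      ; x⇒r = λ i → ⇒r-holds (old (vx i)) i refl (λ ()) (quiet-x⇒r i)
      ; y⇒r = λ i → ⇒r-holds (old (vy i)) i refl (λ ()) (quiet-y⇒r i)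
      ; w⇒r = λ i → ⇒r-holds (old (vw i)) i refl (λ dw → dw) (quiet-w⇒r i)
      ; s⇒¬allR = s⇒¬allR-holds }

    extension : Σ (Assignment (V n + n)) λ M′ →
      evalCNF M′ (ψ n) ≡ true × (∀ k → k ∈ S → evalLit M′ k ≡ true) × M′ t ≡ true
    extension = M , evalCNF-Ψ⁺ M model , M-lits , M-t t∉S ¬t∉S

ψ-FreeExtensions : ∀ n → FreeExtensions (ψ n)
ψ-FreeExtensions n S stable consistent t t∉S ¬t∉S =
  let K , sac = FreeExtension.sacrifice n S stable consistent t t∉S ¬t∉S
  in FreeExtension.Model.extension n S stable consistent t t∉S ¬t∉S K sac

ψ-PC : ∀ n → PC (ψ n)
ψ-PC n = Horn⇒PC (ψ n) (Horn-ψ n) (ψ-FreeExtensions n)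

φ-lower-bound : ∀ n → 2 ≤ n → 1 ≤ n → (χ : CNF (V n)) → PC χ → Equivalent (φ n) χ → 2 ^ (n / 1) ≤ size χ
φ-lower-bound (suc (suc n′)) (s≤s (s≤s z≤n)) _ χ pc φ≡χ rewrite n/1≡n (suc (suc n′)) =
  LowerBound.2^n≤size n′ χ pc φ≡χ

theorem2 :
    Σ (ℕ → ℕ) λ V → Σ ((n : ℕ) → CNF (V n)) λ φ →
      (∀ n → 1 ≤ n → Horn (φ n) × URC (φ n)) ×
      (∃ λ c → ∀ n → 1 ≤ n → size (φ n) ≤ c * n) ×
      (∃ λ c → ∃ λ N → ∀ n → N ≤ n → 1 ≤ n →
         (ψ : CNF (V n)) → PC ψ → Equivalent (φ n) ψ →
         2 ^ (n / suc c) ≤ size ψ) ×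
      (∃ λ c → ∀ n → 1 ≤ n →
         Σ ℕ λ k → Σ (CNF (V n + k)) λ ψ →
           IsEncoding (φ n) ψ × PC ψ × size ψ ≤ c * n)
theorem2 = V , φ ,
  (λ n _ → Horn-φ n , Horn⇒URC (φ n) (Horn-φ n)) ,
  (3 , size-φ-≤) ,
  (0 , 2 , φ-lower-bound) ,
  (7 , λ n 1≤n → n , ψ n , ψ-encodes n , ψ-PC n , size-ψ-≤ n 1≤n)
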